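{- Let $m,n\ge1$ and $\mathbf r=(r_1,\dots,r_m)$ with all $r_l\ge1$. Then, as polynomials in $X$, $$\sum_{|\mu|=n}\frac{n!}{z_\mu}X^{l(\mu)-1}\left(\sum_{i=1}^{l(\mu)}F_{\mu_i}(\mathbf r)\right)=\sum_{k=1}^nF_k(\mathbf r)\,(k-1)!\binom nk (X)_{n-k}=\sum_{k=1}^nS_k(\mathbf r)\,(k-1)!\binom nk(X+k)_{n-k},$$ where the left sum is over all partitions $\mu$ of $n$.
   Context: For a partition $\mu=(\mu_1\geq\cdots\geq\mu_l>0)$ of $n$, $l(\mu)=l$, $m_i(\mu)$ is the multiplicity of the part $i$, and $z_\mu=\prod_{i\ge1}i^{m_i(\mu)}m_i(\mu)!$. The rising factorial is $(x)_s=x(x+1)\cdots(x+s-1)$, $(x)_0=1$. Committee placement: a round table carries $k$ chairs in a fixed cyclic order; a species with $r$ representatives ordered by age chooses a nonempty subset $A$ of its representatives with $|A|=a$, a set $C$ of $a$ chairs and a chair $c\in C$ for the eldest member of $A$; the other members fill the remaining chairs of $C$ by age following the cyclic order after $c$. For $m$ species with $r_1,\dots,r_m$ representatives choosing placements independently (different species may share chairs), $F_k(\mathbf r)$ is the number of resulting configurations at a table with $k$ chairs, and $S_k(\mathbf r)$ the number of those in which every chair is occupied by at least one representative. -}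

module Defs where

open import Level using (Level)
open import Data.Bool using (true; false)
open import Data.Nat using (ℕ; zero; suc; _+_; _*_; _∸_; _^_; _≤_; _≥_; _≟_; _≤?_; NonZero)
open import Data.Nat.Properties using (m*n≢0; m^n≢0; _!≢0; ≤-total)
open import Data.Nat.Combinatorics using (_C_)
open import Data.Nat using (_!)
open import Data.Nat.DivMod using (_/_)
open import Data.Fin using (Fin)
open import Data.Fin.Subset using (Subset; _∈_; ∣_∣; Nonempty; ⋃)
open import Data.Fin.Subset.Properties using (_∈?_; nonempty?)
import Data.Fin.Properties as FinP
open import Data.Vec using (Vec; []; _∷_)
open import Data.List using (List; []; _∷_; map; concatMap; upTo; filter; length; foldr)
open import Data.Nat.ListAction using (sum)
import Data.List as L
open import Data.List.Relation.Unary.All using (All)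
import Data.List.Relation.Unary.All as All
open import Data.List.Relation.Unary.Linked using (Linked; linked?)
open import Data.Product using (_×_; _,_)
open import Data.Unit using (⊤; tt)
open import Relation.Nullary using (Dec; yes; no)
open import Relation.Nullary.Decidable using (_×-dec_)
open import Relation.Binary.PropositionalEquality using (_≡_)
open import Algebra.Bundles using (CommutativeSemiring)

IsPartition : ℕ → List ℕ → Set
IsPartition n μ = All (1 ≤_) μ × Linked _≥_ μ × sum μ ≡ n

isPartition? : ∀ n μ → Dec (IsPartition n μ)
isPartition? n μ =
  All.all? (1 ≤?_) μ ×-dec linked? (λ a b → b ≤? a) μ ×-dec (sum μ ≟ n)

listsOfLength : ℕ → ℕ → List (List ℕ)
listsOfLength n zero = [] ∷ []
listsOfLength n (suc l) =
  concatMap (λ a → map (a ∷_) (listsOfLength n l)) (upTo (suc n))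

-- all lists of length ≤ n with entries ≤ n (each exactly once);
-- every partition of n is among them
candidates : ℕ → List (List ℕ)
candidates n = concatMap (listsOfLength n) (upTo (suc n))

partitions : ℕ → List (List ℕ)
partitions n = filter (isPartition? n) (candidates n)

mult : ℕ → List ℕ → ℕ
mult i μ = length (filter (_≟ i) μ)

zUpTo : List ℕ → ℕ → ℕ
zUpTo μ zero = 1
zUpTo μ (suc i) = (suc i ^ mult (suc i) μ) * (mult (suc i) μ) ! * zUpTo μ i

zUpTo≢0 : ∀ μ b → NonZero (zUpTo μ b)
zUpTo≢0 μ zero = _
zUpTo≢0 μ (suc i) =
  m*n≢0 _ _ {{m*n≢0 _ _ {{m^n≢0 (suc i) (mult (suc i) μ)}} {{mult (suc i) μ !≢0}}}}
            {{zUpTo≢0 μ i}}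

-- z_μ = ∏_{i ≥ 1} i^{m_i(μ)} m_i(μ)!  (factors with i > |μ| are 1)
z : List ℕ → ℕ
z μ = zUpTo μ (sum μ)

-- n! / z_μ  (exact division; z_μ ≠ 0)
permCount : ℕ → List ℕ → ℕ
permCount n μ = _/_ (n !) (z μ) {{zUpTo≢0 μ (sum μ)}}

subsets : ∀ n → List (Subset n)
subsets zero = [] ∷ []
subsets (suc n) = concatMap (λ s → map (s ∷_) (subsets n)) (true ∷ false ∷ [])

-- A placement of a species with r representatives (Fin r, ordered by age)
-- at a table with k chairs (Fin k, in cyclic order): the chosen set A of
-- representatives, the set C of chairs and the chair c of the eldest member
-- of A.  The seating is then determined (the remaining members of A fill the
-- chairs of C by age in the cyclic order after c), and conversely the
-- seating determines (A , C , c), so placements are counted by these triples.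
Placement : ℕ → ℕ → Set
Placement k r = Subset r × Subset k × Fin k

ValidPlacement : ∀ {k r} → Placement k r → Set
ValidPlacement (A , C , c) = Nonempty A × ∣ A ∣ ≡ ∣ C ∣ × c ∈ C

validPlacement? : ∀ {k r} (p : Placement k r) → Dec (ValidPlacement p)
validPlacement? (A , C , c) = nonempty? A ×-dec (∣ A ∣ ≟ ∣ C ∣) ×-dec (c ∈? C)

placements : ∀ k r → List (Placement k r)
placements k r =
  filter validPlacement?
    (concatMap (λ A → concatMap (λ C → map (λ c → (A , C , c)) (FinL k)) (subsets k))
               (subsets r))
  where
  FinL : ∀ k → List (Fin k)
  FinL k = L.allFin k

Config : ∀ {m} → ℕ → Vec ℕ m → Set
Config k [] = ⊤
Config k (r ∷ rs) = Placement k r × Config k rs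

configs : ∀ {m} k (rs : Vec ℕ m) → List (Config k rs)
configs k [] = tt ∷ []
configs k (r ∷ rs) =
  concatMap (λ p → map (p ,_) (configs k rs)) (placements k r)

chairSets : ∀ {m k} (rs : Vec ℕ m) → Config k rs → List (Subset k)
chairSets [] tt = []
chairSets (r ∷ rs) ((A , C , c) , cfg) = C ∷ chairSets rs cfg

AllOccupied : ∀ {m k} (rs : Vec ℕ m) → Config k rs → Set
AllOccupied {k = k} rs cfg = ∀ (j : Fin k) → j ∈ ⋃ (chairSets rs cfg)

allOccupied? : ∀ {m k} (rs : Vec ℕ m) (cfg : Config k rs) → Dec (AllOccupied rs cfg)
allOccupied? rs cfg = FinP.all? (λ j → j ∈? ⋃ (chairSets rs cfg))

F : ∀ {m} → ℕ → Vec ℕ m → ℕ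
F k rs = length (configs k rs)

S : ∀ {m} → ℕ → Vec ℕ m → ℕ
S k rs = length (filter (allOccupied? rs) (configs k rs))

-- Polynomial identities are stated by evaluation at an arbitrary element x
-- of an arbitrary commutative semiring.

module Poly {c ℓ} (R : CommutativeSemiring c ℓ) where
  open CommutativeSemiring R using (Carrier; 0#; 1#; rawSemiring) renaming (_+_ to _⊕_; _*_ to _⊗_)
  open import Algebra.Definitions.RawSemiring rawSemiring using () renaming (_×_ to _×ᴿ_; _^_ to _^ᴿ_) public

  ι : ℕ → Carrier
  ι n = n ×ᴿ 1#

  sumR : List Carrier → Carrier
  sumR = foldr _⊕_ 0#

  prodR : List Carrier → Carrier
  prodR = foldr _⊗_ 1#

  -- rising factorial (x)_s = x (x+1) ⋯ (x+s-1)
  rising : Carrier → ℕ → Carrier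
  rising x s = prodR (map (λ j → x ⊕ ι j) (upTo s))

  oneTo : ℕ → List ℕ
  oneTo n = map suc (upTo n)

  lhs : ∀ {m} → ℕ → Vec ℕ m → Carrier → Carrier
  lhs n rs x = sumR (map (λ μ → ι (permCount n μ) ⊗ (x ^ᴿ (length μ ∸ 1))
                                  ⊗ ι (sum (map (λ p → F p rs) μ)))
                          (partitions n))

  mid : ∀ {m} → ℕ → Vec ℕ m → Carrier → Carrier
  mid n rs x = sumR (map (λ k → ι (F k rs * (k ∸ 1) ! * (n C k)) ⊗ rising x (n ∸ k))
                         (oneTo n))

  rhs : ∀ {m} → ℕ → Vec ℕ m → Carrier → Carrier
  rhs n rs x = sumR (map (λ k → ι (S k rs * (k ∸ 1) ! * (n C k)) ⊗ rising (x ⊕ ι k) (n ∸ k))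
                         (oneTo n))

-- The first identity holds with any weights f k in place of F_k(r).  Since n!/z_μ counts the permutations
-- of n points of cycle type μ, its left side counts permutations with one marked cycle, an unmarked cycle
-- weighted by X and a marked one of length k by f k.  The marked cycle takes (k-1)! C(n,k) choices and
-- leaves an arbitrary permutation of n - k points, and these are counted by (X)_{n-k}.  On partitions this
-- is organised by the multiplicity of the largest part: the sums E and D over partitions with parts at most
-- B satisfy the recursions "remove the cycle through a given point" and "remove the marked cycle", and the
-- first one gives E B s = (X)_s for s ≤ B.
-- For the second identity, sorting configurations by their set of occupied chairs gives
-- F_k = Σ_j C(k,j) S_j, because the weight of a configuration only depends on the sizes of its chair sets
-- (and S_0 = 0 as there is a species).  What remains, Σ_k C(k,j) (k-1)! C(n,k) (X)_{n-k} =
-- (j-1)! C(n,j) (X+j)_{n-j}, is the Vandermonde identity for rising factorials.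

module Submission where

open import Level using (Level)
open import Function using (_∘_)
open import Data.Bool using (Bool; true; false; if_then_else_)
open import Data.Nat using (ℕ; zero; suc; _+_; _*_; _∸_; _≤_; _<_; _!; z≤n; s≤s; NonZero)
import Data.Nat.Properties as ℕ
open import Data.Nat.Combinatorics
  using (_C_; k>n⇒nCk≡0; nCk+nC[k+1]≡[n+1]C[k+1]; nCk≡n!/k![n-k]!; k![n∸k]!∣n!; nCk≡nC[n∸k])
open import Data.Nat.DivMod using (_/_; m/n*n≡m)
open import Data.Nat.Solver using (module +-*-Solver)
open import Data.Fin using (toℕ)
open import Data.Fin.Properties using (toℕ<n)
open import Data.List using (List; []; _∷_; map; _++_; concatMap; filter; applyUpTo; upTo)
open import Data.List.Properties using (map-∘)
open import Data.Vec using (Vec; _∷_)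
open import Data.Product using (_×_; _,_)
open import Relation.Nullary using (Dec; does; yes; no)
open import Relation.Binary.PropositionalEquality as ≡ using (_≡_)
open import Algebra.Bundles using (CommutativeSemiring)
open import Defs using (module Poly; F; S)

module Binomial where

  open ≡ using (refl; cong; cong₂; subst)
  open ≡.≡-Reasoning

  C-pascal : ∀ n k → suc n C suc k ≡ n C k + n C suc k
  C-pascal n k = ≡.sym (nCk+nC[k+1]≡[n+1]C[k+1] n k)

  C-sym : ∀ a b → (a + b) C a ≡ (a + b) C b
  C-sym a b = ≡.trans (nCk≡nC[n∸k] (ℕ.m≤m+n a b)) (cong ((a + b) C_) (ℕ.m+n∸m≡n a b))

  C-factorials : ∀ a b → ((a + b) C a) * (a ! * b !) ≡ (a + b) !
  C-factorials a b = begin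
    ((a + b) C a) * (a ! * b !)                  ≡⟨ cong (λ c → ((a + b) C a) * (a ! * c !)) (≡.sym (ℕ.m+n∸m≡n a b)) ⟩
    ((a + b) C a) * d                            ≡⟨ cong (_* d) (nCk≡n!/k![n-k]! (ℕ.m≤m+n a b)) ⟩
    (a + b) ! / d * d                            ≡⟨ m/n*n≡m (k![n∸k]!∣n! (ℕ.m≤m+n a b)) ⟩
    (a + b) !                                    ∎
    where
    d : ℕ
    d = a ! * (a + b ∸ a) !
    instance
      _ : NonZero d
      _ = ℕ._!*_!≢0 a (a + b ∸ a)

  -- multiplied by a! b! c!, both sides become (a + b + c)!
  C-trinomial-core : ∀ a b c → ((a + b + c) C (a + b)) * ((a + b) C a) ≡ ((a + b + c) C a) * ((b + c) C b)
  C-trinomial-core a b c = ℕ.*-cancelʳ-≡ _ _ (a ! * b ! * c !) {{nz}} (≡.trans lhs≡ (≡.sym rhs≡))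
    where
    open +-*-Solver
    nz : NonZero (a ! * b ! * c !)
    nz = ℕ.m*n≢0 _ _ {{ℕ._!*_!≢0 a b}} {{c ℕ.!≢0}}
    lhs≡ : ((a + b + c) C (a + b)) * ((a + b) C a) * (a ! * b ! * c !) ≡ (a + b + c) !
    lhs≡ = begin
      ((a + b + c) C (a + b)) * ((a + b) C a) * (a ! * b ! * c !)
        ≡⟨ solve 5 (λ X Y p q r → X :* Y :* (p :* q :* r) := X :* ((Y :* (p :* q)) :* r)) refl
             ((a + b + c) C (a + b)) ((a + b) C a) (a !) (b !) (c !) ⟩
      ((a + b + c) C (a + b)) * (((a + b) C a) * (a ! * b !) * c !)
        ≡⟨ cong (λ u → ((a + b + c) C (a + b)) * (u * c !)) (C-factorials a b) ⟩
      ((a + b + c) C (a + b)) * ((a + b) ! * c !)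
        ≡⟨ C-factorials (a + b) c ⟩
      (a + b + c) ! ∎
    rhs≡ : ((a + b + c) C a) * ((b + c) C b) * (a ! * b ! * c !) ≡ (a + b + c) !
    rhs≡ = begin
      ((a + b + c) C a) * ((b + c) C b) * (a ! * b ! * c !)
        ≡⟨ solve 5 (λ X Y p q r → X :* Y :* (p :* q :* r) := X :* (p :* (Y :* (q :* r)))) refl
             ((a + b + c) C a) ((b + c) C b) (a !) (b !) (c !) ⟩
      ((a + b + c) C a) * (a ! * (((b + c) C b) * (b ! * c !)))
        ≡⟨ cong (λ u → ((a + b + c) C a) * (a ! * u)) (C-factorials b c) ⟩
      ((a + b + c) C a) * (a ! * (b + c) !)
        ≡⟨ cong (λ u → (u C a) * (a ! * (b + c) !)) (ℕ.+-assoc a b c) ⟩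
      ((a + (b + c)) C a) * (a ! * (b + c) !)
        ≡⟨ C-factorials a (b + c) ⟩
      (a + (b + c)) !
        ≡⟨ cong _! (≡.sym (ℕ.+-assoc a b c)) ⟩
      (a + b + c) ! ∎

  C-trinomial : ∀ s a b → (s C (a + b)) * ((a + b) C a) ≡ (s C a) * ((s ∸ a) C b)
  C-trinomial s a b with a + b ℕ.≤? s
  ... | yes a+b≤s = begin
    (s C (a + b)) * ((a + b) C a)                ≡⟨ cong (λ t → (t C (a + b)) * ((a + b) C a)) (≡.sym s≡) ⟩
    ((a + b + c) C (a + b)) * ((a + b) C a)      ≡⟨ C-trinomial-core a b c ⟩
    ((a + b + c) C a) * ((b + c) C b)            ≡⟨ cong₂ (λ t u → (t C a) * (u C b)) s≡ (≡.sym s∸a≡) ⟩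
    (s C a) * ((s ∸ a) C b)                      ∎
    where
    c : ℕ
    c = s ∸ (a + b)
    s≡ : a + b + c ≡ s
    s≡ = ℕ.m+[n∸m]≡n a+b≤s
    s∸a≡ : s ∸ a ≡ b + c
    s∸a≡ = ≡.trans (cong (_∸ a) (≡.trans (≡.sym s≡) (ℕ.+-assoc a b c))) (ℕ.m+n∸m≡n a (b + c))
  ... | no a+b≰s = ≡.trans (cong (_* ((a + b) C a)) (k>n⇒nCk≡0 s<a+b)) (≡.sym rhs≡0)
    where
    s<a+b : s < a + b
    s<a+b = ℕ.≰⇒> a+b≰s
    rhs≡0 : (s C a) * ((s ∸ a) C b) ≡ 0
    rhs≡0 with a ℕ.≤? s
    ... | yes a≤s = ≡.trans (cong ((s C a) *_) (k>n⇒nCk≡0 (ℕ.+-cancelˡ-< a (s ∸ a) b (subst (_< a + b) (≡.sym (ℕ.m+[n∸m]≡n a≤s)) s<a+b))))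
                          (ℕ.*-zeroʳ (s C a))
    ... | no a≰s  = cong (_* ((s ∸ a) C b)) (k>n⇒nCk≡0 (ℕ.≰⇒> a≰s))

  C-trinomial-swap : ∀ s a b → (s C a) * ((s ∸ a) C b) ≡ (s C b) * ((s ∸ b) C a)
  C-trinomial-swap s a b = begin
    (s C a) * ((s ∸ a) C b)           ≡⟨ ≡.sym (C-trinomial s a b) ⟩
    (s C (a + b)) * ((a + b) C a)     ≡⟨ cong₂ (λ t u → (s C t) * u) (ℕ.+-comm a b) (C-sym a b) ⟩
    (s C (b + a)) * ((a + b) C b)     ≡⟨ cong (λ t → (s C (b + a)) * (t C b)) (ℕ.+-comm a b) ⟩
    (s C (b + a)) * ((b + a) C b)     ≡⟨ C-trinomial s b a ⟩
    (s C b) * ((s ∸ b) C a)           ∎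

open Binomial

module Sums {c ℓ} (R : CommutativeSemiring c ℓ) where

  open CommutativeSemiring R renaming (_+_ to _⊕_; _*_ to _⊗_)
  open Poly R using (sumR; oneTo)
  open import Algebra.Properties.Semiring.Sum semiring
    using (sum; sum-cong-≋; sum-replicate-zero; ∑-distrib-+; ∑-comm; *-distribˡ-sum; *-distribʳ-sum)
  open import Algebra.Properties.CommutativeSemigroup +-commutativeSemigroup using (interchange)
  open import Relation.Binary.Reasoning.Setoid setoid

  ∑< : ℕ → (ℕ → Carrier) → Carrier
  ∑< n f = sum {n} (λ i → f (toℕ i))

  ∑∈ : ∀ {a} {A : Set a} → List A → (A → Carrier) → Carrier
  ∑∈ xs f = sumR (map f xs)

  ∑<-cong : ∀ n {f g : ℕ → Carrier} → (∀ i → f i ≈ g i) → ∑< n f ≈ ∑< n g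
  ∑<-cong n f≈g = sum-cong-≋ {n} (λ i → f≈g (toℕ i))

  ∑<-congᵇ : ∀ n {f g : ℕ → Carrier} → (∀ i → i < n → f i ≈ g i) → ∑< n f ≈ ∑< n g
  ∑<-congᵇ n f≈g = sum-cong-≋ {n} (λ i → f≈g (toℕ i) (toℕ<n i))

  ∑<-zero : ∀ n {f : ℕ → Carrier} → (∀ i → i < n → f i ≈ 0#) → ∑< n f ≈ 0#
  ∑<-zero n f≈0 = trans (∑<-congᵇ n f≈0) (sum-replicate-zero n)

  ∑<-+ : ∀ n (f g : ℕ → Carrier) → ∑< n (λ i → f i ⊕ g i) ≈ ∑< n f ⊕ ∑< n g
  ∑<-+ n f g = ∑-distrib-+ {n} (λ i → f (toℕ i)) (λ i → g (toℕ i))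

  ∑<-*ˡ : ∀ n a (f : ℕ → Carrier) → a ⊗ ∑< n f ≈ ∑< n (λ i → a ⊗ f i)
  ∑<-*ˡ n a f = *-distribˡ-sum {n} a (λ i → f (toℕ i))

  ∑<-*ʳ : ∀ n a (f : ℕ → Carrier) → ∑< n f ⊗ a ≈ ∑< n (λ i → f i ⊗ a)
  ∑<-*ʳ n a f = *-distribʳ-sum {n} a (λ i → f (toℕ i))

  ∑<-comm : ∀ m n (f : ℕ → ℕ → Carrier) → ∑< m (λ i → ∑< n (f i)) ≈ ∑< n (λ j → ∑< m (λ i → f i j))
  ∑<-comm m n f = ∑-comm {m} {n} (λ i j → f (toℕ i) (toℕ j))

  ∑<-split : ∀ a b (f : ℕ → Carrier) → ∑< (a + b) f ≈ ∑< a f ⊕ ∑< b (λ t → f (a + t))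
  ∑<-split zero    b f = sym (+-identityˡ _)
  ∑<-split (suc a) b f = trans (+-congˡ (∑<-split a b (f ∘ suc))) (sym (+-assoc _ _ _))

  ∑<-last : ∀ n (f : ℕ → Carrier) → ∑< (suc n) f ≈ ∑< n f ⊕ f n
  ∑<-last zero    f = trans (+-identityʳ _) (sym (+-identityˡ _))
  ∑<-last (suc n) f = trans (+-congˡ (∑<-last n (f ∘ suc))) (sym (+-assoc _ _ _))

  ∑<-truncate : ∀ {a n} (f : ℕ → Carrier) → a ≤ n → (∀ i → a ≤ i → f i ≈ 0#) → ∑< n f ≈ ∑< a f
  ∑<-truncate {a} {n} f a≤n tail≈0 = begin
    ∑< n f                                ≡⟨ ≡.cong (λ k → ∑< k f) (≡.sym (ℕ.m+[n∸m]≡n a≤n)) ⟩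
    ∑< (a + (n ∸ a)) f                    ≈⟨ ∑<-split a (n ∸ a) f ⟩
    ∑< a f ⊕ ∑< (n ∸ a) (λ t → f (a + t)) ≈⟨ +-congˡ (∑<-zero (n ∸ a) (λ t _ → tail≈0 (a + t) (ℕ.m≤m+n a t))) ⟩
    ∑< a f ⊕ 0#                           ≈⟨ +-identityʳ _ ⟩
    ∑< a f                                ∎

  ∑∈-cong : ∀ {a} {A : Set a} (xs : List A) {f g : A → Carrier} → (∀ x → f x ≈ g x) → ∑∈ xs f ≈ ∑∈ xs g
  ∑∈-cong []       f≈g = refl
  ∑∈-cong (x ∷ xs) f≈g = +-cong (f≈g x) (∑∈-cong xs f≈g)

  ∑∈-zero : ∀ {a} {A : Set a} (xs : List A) → ∑∈ xs (λ _ → 0#) ≈ 0#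
  ∑∈-zero []       = refl
  ∑∈-zero (x ∷ xs) = trans (+-identityˡ _) (∑∈-zero xs)

  ∑∈-+ : ∀ {a} {A : Set a} (xs : List A) (f g : A → Carrier) → ∑∈ xs (λ x → f x ⊕ g x) ≈ ∑∈ xs f ⊕ ∑∈ xs g
  ∑∈-+ []       f g = sym (+-identityˡ 0#)
  ∑∈-+ (x ∷ xs) f g = trans (+-congˡ (∑∈-+ xs f g)) (interchange (f x) (g x) _ _)

  ∑∈-*ˡ : ∀ {a} {A : Set a} (xs : List A) c (f : A → Carrier) → c ⊗ ∑∈ xs f ≈ ∑∈ xs (λ x → c ⊗ f x)
  ∑∈-*ˡ []       c f = zeroʳ c
  ∑∈-*ˡ (x ∷ xs) c f = trans (distribˡ c (f x) _) (+-congˡ (∑∈-*ˡ xs c f))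

  ∑∈-*ʳ : ∀ {a} {A : Set a} (xs : List A) c (f : A → Carrier) → ∑∈ xs f ⊗ c ≈ ∑∈ xs (λ x → f x ⊗ c)
  ∑∈-*ʳ []       c f = zeroˡ c
  ∑∈-*ʳ (x ∷ xs) c f = trans (distribʳ c (f x) _) (+-congˡ (∑∈-*ʳ xs c f))

  ∑∈-∑<-comm : ∀ {a} {A : Set a} (xs : List A) n (f : A → ℕ → Carrier) →
               ∑∈ xs (λ x → ∑< n (f x)) ≈ ∑< n (λ i → ∑∈ xs (λ x → f x i))
  ∑∈-∑<-comm []       n f = sym (∑<-zero n {λ _ → 0#} (λ _ _ → refl))
  ∑∈-∑<-comm (x ∷ xs) n f = trans (+-congˡ (∑∈-∑<-comm xs n f)) (sym (∑<-+ n (f x) (λ i → ∑∈ xs (λ y → f y i))))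

  ∑∈-comm : ∀ {a b} {A : Set a} {B : Set b} (xs : List A) (ys : List B) (f : A → B → Carrier) →
            ∑∈ xs (λ x → ∑∈ ys (f x)) ≈ ∑∈ ys (λ y → ∑∈ xs (λ x → f x y))
  ∑∈-comm []       ys f = sym (∑∈-zero ys)
  ∑∈-comm (x ∷ xs) ys f = trans (+-congˡ (∑∈-comm xs ys f)) (sym (∑∈-+ ys (f x) _))

  ∑∈-++ : ∀ {a} {A : Set a} (xs ys : List A) (f : A → Carrier) → ∑∈ (xs ++ ys) f ≈ ∑∈ xs f ⊕ ∑∈ ys f
  ∑∈-++ []       ys f = sym (+-identityˡ _)
  ∑∈-++ (x ∷ xs) ys f = trans (+-congˡ (∑∈-++ xs ys f)) (sym (+-assoc _ _ _))

  ∑∈-map : ∀ {a b} {A : Set a} {B : Set b} (h : A → B) (xs : List A) (f : B → Carrier) →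
           ∑∈ (map h xs) f ≈ ∑∈ xs (f ∘ h)
  ∑∈-map h xs f = reflexive (≡.cong sumR (≡.sym (map-∘ xs)))

  ∑∈-concatMap : ∀ {a b} {A : Set a} {B : Set b} (h : A → List B) (xs : List A) (f : B → Carrier) →
                 ∑∈ (concatMap h xs) f ≈ ∑∈ xs (λ x → ∑∈ (h x) f)
  ∑∈-concatMap h []       f = refl
  ∑∈-concatMap h (x ∷ xs) f = trans (∑∈-++ (h x) (concatMap h xs) f) (+-congˡ (∑∈-concatMap h xs f))

  when : Bool → Carrier → Carrier
  when b y = if b then y else 0#

  when-cong : ∀ b {x y} → (b ≡ true → x ≈ y) → when b x ≈ when b y
  when-cong true  x≈y = x≈y ≡.refl
  when-cong false x≈y = refl

  when-*ˡ : ∀ b a y → a ⊗ when b y ≈ when b (a ⊗ y)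
  when-*ˡ true  a y = refl
  when-*ˡ false a y = zeroʳ a

  when-*ʳ : ∀ b a y → when b y ⊗ a ≈ when b (y ⊗ a)
  when-*ʳ true  a y = refl
  when-*ʳ false a y = zeroˡ a

  when-+ : ∀ b x y → when b (x ⊕ y) ≈ when b x ⊕ when b y
  when-+ true  x y = refl
  when-+ false x y = sym (+-identityˡ 0#)

  ∑∈-when : ∀ {a} {A : Set a} b (xs : List A) (f : A → Carrier) → ∑∈ xs (λ x → when b (f x)) ≈ when b (∑∈ xs f)
  ∑∈-when true  xs f = refl
  ∑∈-when false xs f = ∑∈-zero xs

  ∑<-when : ∀ b n (f : ℕ → Carrier) → ∑< n (λ i → when b (f i)) ≈ when b (∑< n f)
  ∑<-when true  n f = refl
  ∑<-when false n f = ∑<-zero n {λ _ → 0#} (λ _ _ → refl)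

  ∑∈-filter : ∀ {a p} {A : Set a} {P : A → Set p} (P? : ∀ x → Dec (P x)) (xs : List A) (f : A → Carrier) →
              ∑∈ (filter P? xs) f ≈ ∑∈ xs (λ x → when (does (P? x)) (f x))
  ∑∈-filter P? []       f = refl
  ∑∈-filter P? (x ∷ xs) f with does (P? x)
  ... | true  = +-congˡ (∑∈-filter P? xs f)
  ... | false = trans (∑∈-filter P? xs f) (sym (+-identityˡ _))

  ∑∈-applyUpTo : ∀ {a} {A : Set a} (h : ℕ → A) n (f : A → Carrier) → ∑∈ (applyUpTo h n) f ≈ ∑< n (f ∘ h)
  ∑∈-applyUpTo h zero    f = refl
  ∑∈-applyUpTo h (suc n) f = +-congˡ (∑∈-applyUpTo (h ∘ suc) n f)

  ∑∈-oneTo : ∀ n (f : ℕ → Carrier) → ∑∈ (oneTo n) f ≈ ∑< n (f ∘ suc)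
  ∑∈-oneTo n f = trans (∑∈-map suc (upTo n) f) (∑∈-applyUpTo (λ i → i) n (f ∘ suc))

module ℕΣ = Sums ℕ.+-*-commutativeSemiring

module Scalars {c ℓ} (R : CommutativeSemiring c ℓ) where

  open CommutativeSemiring R renaming (_+_ to _⊕_; _*_ to _⊗_)
  open Poly R using (ι)
  open Sums R
  import Algebra.Properties.Semiring.Mult semiring as Mult
  open import Relation.Binary.Reasoning.Setoid setoid

  ι-+ : ∀ a b → ι (a + b) ≈ ι a ⊕ ι b
  ι-+ = Mult.×-homo-+ 1#

  ι-* : ∀ a b → ι (a * b) ≈ ι a ⊗ ι b
  ι-* = Mult.×1-homo-*

  ι-1 : ι 1 ≈ 1#
  ι-1 = +-identityʳ 1#

  ι-cong : ∀ {a b} → a ≡ b → ι a ≈ ι b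
  ι-cong = reflexive ∘ ≡.cong ι

  ι-∑< : ∀ n (f : ℕ → ℕ) → ι (ℕΣ.∑< n f) ≈ ∑< n (ι ∘ f)
  ι-∑< zero    f = refl
  ι-∑< (suc n) f = trans (ι-+ (f 0) _) (+-congˡ (ι-∑< n (f ∘ suc)))

  ∑<-pascal : ∀ N (w : ℕ → Carrier) →
              ∑< (suc (suc N)) (λ t → ι (suc N C t) ⊗ w t)
              ≈ ∑< (suc N) (λ t → ι (N C t) ⊗ w t) ⊕ ∑< (suc N) (λ t → ι (N C t) ⊗ w (suc t))
  ∑<-pascal N w = begin
    ι 1 ⊗ w 0 ⊕ ∑< (suc N) (λ t → ι (suc N C suc t) ⊗ w (suc t))
      ≈⟨ +-congˡ (∑<-cong (suc N) split) ⟩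
    ι 1 ⊗ w 0 ⊕ ∑< (suc N) (λ t → ι (N C t) ⊗ w (suc t) ⊕ ι (N C suc t) ⊗ w (suc t))
      ≈⟨ +-congˡ (∑<-+ (suc N) (λ t → ι (N C t) ⊗ w (suc t)) (λ t → ι (N C suc t) ⊗ w (suc t))) ⟩
    ι 1 ⊗ w 0 ⊕ (B ⊕ ∑< (suc N) (λ t → ι (N C suc t) ⊗ w (suc t)))
      ≈⟨ +-congˡ (+-congˡ (∑<-last N (λ t → ι (N C suc t) ⊗ w (suc t)))) ⟩
    ι 1 ⊗ w 0 ⊕ (B ⊕ (A ⊕ ι (N C suc N) ⊗ w (suc N)))
      ≈⟨ +-congˡ (+-congˡ (trans (+-congˡ top≈0) (+-identityʳ A))) ⟩
    ι 1 ⊗ w 0 ⊕ (B ⊕ A)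
      ≈⟨ +-congˡ (+-comm B A) ⟩
    ι 1 ⊗ w 0 ⊕ (A ⊕ B)
      ≈⟨ sym (+-assoc _ A B) ⟩
    (ι 1 ⊗ w 0 ⊕ A) ⊕ B ∎
    where
    A B : Carrier
    A = ∑< N (λ t → ι (N C suc t) ⊗ w (suc t))
    B = ∑< (suc N) (λ t → ι (N C t) ⊗ w (suc t))
    split : ∀ t → ι (suc N C suc t) ⊗ w (suc t) ≈ ι (N C t) ⊗ w (suc t) ⊕ ι (N C suc t) ⊗ w (suc t)
    split t = trans (*-congʳ (trans (ι-cong (C-pascal N t)) (ι-+ (N C t) (N C suc t)))) (distribʳ _ _ _)
    top≈0 : ι (N C suc N) ⊗ w (suc N) ≈ 0#
    top≈0 = trans (*-congʳ (ι-cong (k>n⇒nCk≡0 (ℕ.n<1+n N)))) (zeroˡ _)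

module Rising {c ℓ} (R : CommutativeSemiring c ℓ) where

  open CommutativeSemiring R renaming (_+_ to _⊕_; _*_ to _⊗_)
  open Poly R using (ι; prodR; rising)
  open Sums R
  open Scalars R
  open import Algebra.Solver.Ring.NaturalCoefficients.Default R using (solve; _:+_; _:*_; _:=_; con)
  open import Relation.Binary.Reasoning.Setoid setoid

  prodR-applyUpTo-last : ∀ (g : ℕ → Carrier) (h : ℕ → ℕ) n →
                         prodR (map g (applyUpTo h (suc n))) ≈ prodR (map g (applyUpTo h n)) ⊗ g (h n)
  prodR-applyUpTo-last g h zero    = trans (*-identityʳ _) (sym (*-identityˡ _))
  prodR-applyUpTo-last g h (suc n) = trans (*-congˡ (prodR-applyUpTo-last g (h ∘ suc) n)) (sym (*-assoc _ _ _))

  rising-suc : ∀ x s → rising x (suc s) ≈ rising x s ⊗ (x ⊕ ι s)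
  rising-suc x = prodR-applyUpTo-last (λ j → x ⊕ ι j) (λ i → i)

  rising-cong : ∀ {x y} s → x ≈ y → rising x s ≈ rising y s
  rising-cong zero    x≈y = refl
  rising-cong (suc s) x≈y = trans (rising-suc _ s) (trans (*-cong (rising-cong s x≈y) (+-congʳ x≈y)) (sym (rising-suc _ s)))

  rising-sucˡ : ∀ x s → rising x (suc s) ≈ x ⊗ rising (1# ⊕ x) s
  rising-sucˡ x zero    = *-congʳ (+-identityʳ x)
  rising-sucˡ x (suc s) = begin
    rising x (suc (suc s))                         ≈⟨ rising-suc x (suc s) ⟩
    rising x (suc s) ⊗ (x ⊕ (1# ⊕ ι s))            ≈⟨ *-congʳ (rising-sucˡ x s) ⟩
    x ⊗ rising (1# ⊕ x) s ⊗ (x ⊕ (1# ⊕ ι s))       ≈⟨ solve 3 (λ x r i → x :* r :* (x :+ (con 1 :+ i)) := x :* (r :* ((con 1 :+ x) :+ i)))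
                                                              refl x (rising (1# ⊕ x) s) (ι s) ⟩
    x ⊗ (rising (1# ⊕ x) s ⊗ ((1# ⊕ x) ⊕ ι s))     ≈⟨ *-congˡ (sym (rising-suc (1# ⊕ x) s)) ⟩
    x ⊗ rising (1# ⊕ x) (suc s)                    ∎

  rising-vandermonde : ∀ a b N →
                       rising (a ⊕ b) N ≈ ∑< (suc N) (λ t → ι (N C t) ⊗ (rising a t ⊗ rising b (N ∸ t)))
  rising-vandermonde a b zero    = sym (trans (+-identityʳ _) (trans (*-cong ι-1 (*-identityˡ 1#)) (*-identityˡ 1#)))
  rising-vandermonde a b (suc N) = begin
    rising (a ⊕ b) (suc N)
      ≈⟨ rising-suc (a ⊕ b) N ⟩
    rising (a ⊕ b) N ⊗ ((a ⊕ b) ⊕ ι N)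
      ≈⟨ *-congʳ (rising-vandermonde a b N) ⟩
    ∑< (suc N) (λ t → ι (N C t) ⊗ (rising a t ⊗ rising b (N ∸ t))) ⊗ ((a ⊕ b) ⊕ ι N)
      ≈⟨ ∑<-*ʳ (suc N) _ (λ t → ι (N C t) ⊗ (rising a t ⊗ rising b (N ∸ t))) ⟩
    ∑< (suc N) (λ t → ι (N C t) ⊗ (rising a t ⊗ rising b (N ∸ t)) ⊗ ((a ⊕ b) ⊕ ι N))
      ≈⟨ ∑<-congᵇ (suc N) (λ t t<1+N → raise-one-side t (ℕ.≤-pred t<1+N)) ⟩
    ∑< (suc N) (λ t → ι (N C t) ⊗ w (suc t) ⊕ ι (N C t) ⊗ w t)
      ≈⟨ ∑<-+ (suc N) (λ t → ι (N C t) ⊗ w (suc t)) (λ t → ι (N C t) ⊗ w t) ⟩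
    ∑< (suc N) (λ t → ι (N C t) ⊗ w (suc t)) ⊕ ∑< (suc N) (λ t → ι (N C t) ⊗ w t)
      ≈⟨ +-comm _ _ ⟩
    ∑< (suc N) (λ t → ι (N C t) ⊗ w t) ⊕ ∑< (suc N) (λ t → ι (N C t) ⊗ w (suc t))
      ≈⟨ sym (∑<-pascal N w) ⟩
    ∑< (suc (suc N)) (λ t → ι (suc N C t) ⊗ w t) ∎
    where
    w : ℕ → Carrier
    w t = rising a t ⊗ rising b (suc N ∸ t)
    raise-one-side : ∀ t → t ≤ N → ι (N C t) ⊗ (rising a t ⊗ rising b (N ∸ t)) ⊗ ((a ⊕ b) ⊕ ι N)
                                   ≈ ι (N C t) ⊗ w (suc t) ⊕ ι (N C t) ⊗ w t
    raise-one-side t t≤N = begin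
      κ ⊗ (rising a t ⊗ rising b (N ∸ t)) ⊗ ((a ⊕ b) ⊕ ι N)
        ≈⟨ *-congˡ (+-congˡ (trans (ι-cong (≡.sym (ℕ.m+[n∸m]≡n t≤N))) (ι-+ t (N ∸ t)))) ⟩
      κ ⊗ (rising a t ⊗ rising b (N ∸ t)) ⊗ ((a ⊕ b) ⊕ (ι t ⊕ ι (N ∸ t)))
        ≈⟨ solve 7 (λ c ra rb a b i j → c :* (ra :* rb) :* ((a :+ b) :+ (i :+ j))
                                         := c :* ((ra :* (a :+ i)) :* rb) :+ c :* (ra :* (rb :* (b :+ j))))
                   refl κ (rising a t) (rising b (N ∸ t)) a b (ι t) (ι (N ∸ t)) ⟩
      κ ⊗ ((rising a t ⊗ (a ⊕ ι t)) ⊗ rising b (N ∸ t)) ⊕ κ ⊗ (rising a t ⊗ (rising b (N ∸ t) ⊗ (b ⊕ ι (N ∸ t))))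
        ≈⟨ +-cong (*-congˡ (*-congʳ (sym (rising-suc a t)))) (*-congˡ (*-congˡ (sym (rising-suc b (N ∸ t))))) ⟩
      κ ⊗ w (suc t) ⊕ κ ⊗ (rising a t ⊗ rising b (suc (N ∸ t)))
        ≡⟨ ≡.cong (λ k → κ ⊗ w (suc t) ⊕ κ ⊗ (rising a t ⊗ rising b k)) (≡.sym (ℕ.+-∸-assoc 1 t≤N)) ⟩
      κ ⊗ w (suc t) ⊕ κ ⊗ w t ∎
      where
      κ : Carrier
      κ = ι (N C t)

  factorial-rising : ∀ j t → ι ((j + t) !) ≈ ι (j !) ⊗ rising (ι (suc j)) t
  factorial-rising j zero    = trans (ι-cong (≡.cong _! (ℕ.+-identityʳ j))) (sym (*-identityʳ _))
  factorial-rising j (suc t) = begin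
    ι ((j + suc t) !)                                    ≡⟨ ≡.cong (ι ∘ _!) (ℕ.+-suc j t) ⟩
    ι (suc (j + t) * (j + t) !)                          ≈⟨ ι-* (suc (j + t)) ((j + t) !) ⟩
    ι (suc (j + t)) ⊗ ι ((j + t) !)                      ≈⟨ *-cong (ι-+ (suc j) t) (factorial-rising j t) ⟩
    (ι (suc j) ⊕ ι t) ⊗ (ι (j !) ⊗ rising (ι (suc j)) t) ≈⟨ solve 3 (λ p f r → p :* (f :* r) := f :* (r :* p)) refl (ι (suc j) ⊕ ι t) (ι (j !)) (rising (ι (suc j)) t) ⟩
    ι (j !) ⊗ (rising (ι (suc j)) t ⊗ (ι (suc j) ⊕ ι t)) ≈⟨ *-congˡ (sym (rising-suc (ι (suc j)) t)) ⟩
    ι (j !) ⊗ rising (ι (suc j)) (suc t)                 ∎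

  rising-one : ∀ k → rising 1# k ≈ ι (k !)
  rising-one k = begin
    rising 1# k              ≈⟨ rising-cong k (sym ι-1) ⟩
    rising (ι 1) k           ≈⟨ sym (trans (*-congʳ ι-1) (*-identityˡ _)) ⟩
    ι 1 ⊗ rising (ι 1) k     ≈⟨ sym (factorial-rising 0 k) ⟩
    ι (k !)                  ∎

module RisingTransform {c ℓ} (R : CommutativeSemiring c ℓ) where

  open CommutativeSemiring R renaming (_+_ to _⊕_; _*_ to _⊗_)
  open Poly R using (ι; rising; oneTo)
  open Sums R
  open Scalars R
  open Rising R
  open import Algebra.Solver.Ring.NaturalCoefficients.Default R using (solve; _:+_; _:*_; _:=_)
  open import Relation.Binary.Reasoning.Setoid setoid

  private
    [j+1+N]∸[j+1]≡N : ∀ j N → j + suc N ∸ suc j ≡ N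
    [j+1+N]∸[j+1]≡N j N = ≡.trans (≡.cong (_∸ suc j) (ℕ.+-suc j N)) (ℕ.m+n∸m≡n j N)

    C-rising-term : ∀ x j N t → let n = j + suc N in
      ι (suc (j + t) C suc j) ⊗ (ι ((j + t) ! * (n C suc (j + t))) ⊗ rising x (n ∸ suc (j + t)))
      ≈ ι (j ! * (n C suc j)) ⊗ (ι (N C t) ⊗ (rising (ι (suc j)) t ⊗ rising x (N ∸ t)))
    C-rising-term x j N t = begin
      ι A ⊗ (ι ((j + t) ! * B) ⊗ rising x (n ∸ suc (j + t)))
        ≈⟨ *-congˡ (*-cong (ι-* ((j + t) !) B) (reflexive (≡.cong (rising x) n∸1+j+t≡N∸t))) ⟩
      ι A ⊗ (ι ((j + t) !) ⊗ ι B ⊗ rising x (N ∸ t))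
        ≈⟨ solve 4 (λ a f b r → a :* (f :* b :* r) := b :* a :* f :* r) refl (ι A) (ι ((j + t) !)) (ι B) (rising x (N ∸ t)) ⟩
      ι B ⊗ ι A ⊗ ι ((j + t) !) ⊗ rising x (N ∸ t)
        ≈⟨ *-congʳ (*-cong (trans (sym (ι-* B A)) (ι-cong trinomial)) (factorial-rising j t)) ⟩
      ι ((n C suc j) * (N C t)) ⊗ (ι (j !) ⊗ rising (ι (suc j)) t) ⊗ rising x (N ∸ t)
        ≈⟨ *-congʳ (*-congʳ (ι-* (n C suc j) (N C t))) ⟩
      ι (n C suc j) ⊗ ι (N C t) ⊗ (ι (j !) ⊗ rising (ι (suc j)) t) ⊗ rising x (N ∸ t)
        ≈⟨ solve 5 (λ c d f r s → c :* d :* (f :* r) :* s := f :* c :* (d :* (r :* s))) refl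
             (ι (n C suc j)) (ι (N C t)) (ι (j !)) (rising (ι (suc j)) t) (rising x (N ∸ t)) ⟩
      ι (j !) ⊗ ι (n C suc j) ⊗ (ι (N C t) ⊗ (rising (ι (suc j)) t ⊗ rising x (N ∸ t)))
        ≈⟨ *-congʳ (sym (ι-* (j !) (n C suc j))) ⟩
      ι (j ! * (n C suc j)) ⊗ (ι (N C t) ⊗ (rising (ι (suc j)) t ⊗ rising x (N ∸ t))) ∎
      where
      n A B : ℕ
      n = j + suc N
      A = suc (j + t) C suc j
      B = n C suc (j + t)
      n∸1+j+t≡N∸t : n ∸ suc (j + t) ≡ N ∸ t
      n∸1+j+t≡N∸t = ≡.trans (≡.cong (_∸ suc (j + t)) (ℕ.+-suc j N)) (ℕ.[m+n]∸[m+o]≡n∸o j N t)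
      trinomial : B * A ≡ (n C suc j) * (N C t)
      trinomial = ≡.trans (C-trinomial n (suc j) t) (≡.cong (λ m → (n C suc j) * (m C t)) ([j+1+N]∸[j+1]≡N j N))

    ∑-C-rising-shifted : ∀ x j N → let n = j + suc N in
      ∑< n (λ i → ι (suc i C suc j) ⊗ (ι (i ! * (n C suc i)) ⊗ rising x (n ∸ suc i)))
      ≈ ι (j ! * (n C suc j)) ⊗ rising (x ⊕ ι (suc j)) (n ∸ suc j)
    ∑-C-rising-shifted x j N = begin
      ∑< n T
        ≈⟨ ∑<-split j (suc N) T ⟩
      ∑< j T ⊕ ∑< (suc N) (λ t → T (j + t))
        ≈⟨ +-congʳ (∑<-zero j {T} (λ i i<j → trans (*-congʳ (ι-cong (k>n⇒nCk≡0 (s≤s i<j)))) (zeroˡ _))) ⟩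
      0# ⊕ ∑< (suc N) (λ t → T (j + t))
        ≈⟨ trans (+-identityˡ _) (∑<-cong (suc N) (C-rising-term x j N)) ⟩
      ∑< (suc N) (λ t → K ⊗ (ι (N C t) ⊗ (rising (ι (suc j)) t ⊗ rising x (N ∸ t))))
        ≈⟨ sym (∑<-*ˡ (suc N) K (λ t → ι (N C t) ⊗ (rising (ι (suc j)) t ⊗ rising x (N ∸ t)))) ⟩
      K ⊗ ∑< (suc N) (λ t → ι (N C t) ⊗ (rising (ι (suc j)) t ⊗ rising x (N ∸ t)))
        ≈⟨ *-congˡ (sym (rising-vandermonde (ι (suc j)) x N)) ⟩
      K ⊗ rising (ι (suc j) ⊕ x) N
        ≈⟨ *-congˡ (rising-cong N (+-comm _ x)) ⟩
      K ⊗ rising (x ⊕ ι (suc j)) N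
        ≡⟨ ≡.cong (λ m → K ⊗ rising (x ⊕ ι (suc j)) m) (≡.sym ([j+1+N]∸[j+1]≡N j N)) ⟩
      K ⊗ rising (x ⊕ ι (suc j)) (n ∸ suc j) ∎
      where
      n : ℕ
      n = j + suc N
      K : Carrier
      K = ι (j ! * (n C suc j))
      T : ℕ → Carrier
      T i = ι (suc i C suc j) ⊗ (ι (i ! * (n C suc i)) ⊗ rising x (n ∸ suc i))

  -- Σ_{k=1}^{n} C(k,a) (k-1)! C(n,k) (x)_{n-k} = (a-1)! C(n,a) (x+a)_{n-a}, with k = i+1 and a = j+1
  ∑-C-rising : ∀ x n j → j < n →
    ∑< n (λ i → ι (suc i C suc j) ⊗ (ι (i ! * (n C suc i)) ⊗ rising x (n ∸ suc i)))
    ≈ ι (j ! * (n C suc j)) ⊗ rising (x ⊕ ι (suc j)) (n ∸ suc j)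
  ∑-C-rising x n j j<n = ≡.subst
    (λ n → ∑< n (λ i → ι (suc i C suc j) ⊗ (ι (i ! * (n C suc i)) ⊗ rising x (n ∸ suc i)))
           ≈ ι (j ! * (n C suc j)) ⊗ rising (x ⊕ ι (suc j)) (n ∸ suc j))
    (≡.trans (ℕ.+-suc j (n ∸ suc j)) (ℕ.m+[n∸m]≡n j<n))
    (∑-C-rising-shifted x j (n ∸ suc j))

  ι-*-assoc : ∀ a b c r → ι (a * b * c) ⊗ r ≈ ι a ⊗ (ι (b * c) ⊗ r)
  ι-*-assoc a b c r = trans (*-congʳ (trans (ι-cong (ℕ.*-assoc a b c)) (ι-* a (b * c)))) (*-assoc _ _ _)

  ι-binomial-transform : ∀ (f g : ℕ → ℕ) → (∀ k → f k ≡ ℕΣ.∑< (suc k) (λ j → (k C j) * g j)) → g 0 ≡ 0 →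
                         ∀ n i → i < n → ι (f (suc i)) ≈ ∑< n (λ j → ι (suc i C suc j) ⊗ ι (g (suc j)))
  ι-binomial-transform f g f≡∑Cg g0≡0 n i i<n = begin
    ι (f (suc i))
      ≈⟨ trans (ι-cong (f≡∑Cg (suc i))) (ι-∑< (suc (suc i)) (λ j → (suc i C j) * g j)) ⟩
    ι (1 * g 0) ⊕ ∑< (suc i) (λ j → ι ((suc i C suc j) * g (suc j)))
      ≈⟨ +-cong (ι-cong (≡.cong (1 *_) g0≡0)) (∑<-cong (suc i) (λ j → ι-* (suc i C suc j) (g (suc j)))) ⟩
    0# ⊕ ∑< (suc i) (λ j → ι (suc i C suc j) ⊗ ι (g (suc j)))
      ≈⟨ +-identityˡ _ ⟩
    ∑< (suc i) (λ j → ι (suc i C suc j) ⊗ ι (g (suc j)))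
      ≈⟨ sym (∑<-truncate (λ j → ι (suc i C suc j) ⊗ ι (g (suc j))) i<n
                (λ j i<j → trans (*-congʳ (ι-cong (k>n⇒nCk≡0 (s≤s i<j)))) (zeroˡ _))) ⟩
    ∑< n (λ j → ι (suc i C suc j) ⊗ ι (g (suc j))) ∎

  binomial-rising-transform :
    ∀ (f g : ℕ → ℕ) → (∀ k → f k ≡ ℕΣ.∑< (suc k) (λ j → (k C j) * g j)) → g 0 ≡ 0 → ∀ n x →
    ∑∈ (oneTo n) (λ k → ι (f k * (k ∸ 1) ! * (n C k)) ⊗ rising x (n ∸ k))
    ≈ ∑∈ (oneTo n) (λ k → ι (g k * (k ∸ 1) ! * (n C k)) ⊗ rising (x ⊕ ι k) (n ∸ k))
  binomial-rising-transform f g f≡∑Cg g0≡0 n x = begin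
    ∑∈ (oneTo n) (λ k → ι (f k * (k ∸ 1) ! * (n C k)) ⊗ rising x (n ∸ k))
      ≈⟨ ∑∈-oneTo n (λ k → ι (f k * (k ∸ 1) ! * (n C k)) ⊗ rising x (n ∸ k)) ⟩
    ∑< n (λ i → ι (f (suc i) * i ! * (n C suc i)) ⊗ rising x (n ∸ suc i))
      ≈⟨ ∑<-congᵇ n expand ⟩
    ∑< n (λ i → ∑< n (λ j → ι (g (suc j)) ⊗ T i j))
      ≈⟨ ∑<-comm n n (λ i j → ι (g (suc j)) ⊗ T i j) ⟩
    ∑< n (λ j → ∑< n (λ i → ι (g (suc j)) ⊗ T i j))
      ≈⟨ ∑<-congᵇ n collapse ⟩
    ∑< n (λ j → ι (g (suc j) * j ! * (n C suc j)) ⊗ rising (x ⊕ ι (suc j)) (n ∸ suc j))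
      ≈⟨ sym (∑∈-oneTo n (λ k → ι (g k * (k ∸ 1) ! * (n C k)) ⊗ rising (x ⊕ ι k) (n ∸ k))) ⟩
    ∑∈ (oneTo n) (λ k → ι (g k * (k ∸ 1) ! * (n C k)) ⊗ rising (x ⊕ ι k) (n ∸ k)) ∎
    where
    T : ℕ → ℕ → Carrier
    T i j = ι (suc i C suc j) ⊗ (ι (i ! * (n C suc i)) ⊗ rising x (n ∸ suc i))
    expand : ∀ i → i < n → ι (f (suc i) * i ! * (n C suc i)) ⊗ rising x (n ∸ suc i) ≈ ∑< n (λ j → ι (g (suc j)) ⊗ T i j)
    expand i i<n = begin
      ι (f (suc i) * i ! * (n C suc i)) ⊗ rising x (n ∸ suc i)
        ≈⟨ trans (ι-*-assoc (f (suc i)) (i !) (n C suc i) _) (*-congʳ (ι-binomial-transform f g f≡∑Cg g0≡0 n i i<n)) ⟩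
      ∑< n (λ j → ι (suc i C suc j) ⊗ ι (g (suc j))) ⊗ W
        ≈⟨ ∑<-*ʳ n W (λ j → ι (suc i C suc j) ⊗ ι (g (suc j))) ⟩
      ∑< n (λ j → ι (suc i C suc j) ⊗ ι (g (suc j)) ⊗ W)
        ≈⟨ ∑<-cong n (λ j → trans (*-congʳ (*-comm (ι (suc i C suc j)) (ι (g (suc j))))) (*-assoc _ _ _)) ⟩
      ∑< n (λ j → ι (g (suc j)) ⊗ T i j) ∎
      where
      W : Carrier
      W = ι (i ! * (n C suc i)) ⊗ rising x (n ∸ suc i)
    collapse : ∀ j → j < n → ∑< n (λ i → ι (g (suc j)) ⊗ T i j)
                             ≈ ι (g (suc j) * j ! * (n C suc j)) ⊗ rising (x ⊕ ι (suc j)) (n ∸ suc j)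
    collapse j j<n = begin
      ∑< n (λ i → ι (g (suc j)) ⊗ T i j)
        ≈⟨ sym (∑<-*ˡ n (ι (g (suc j))) (λ i → T i j)) ⟩
      ι (g (suc j)) ⊗ ∑< n (λ i → T i j)
        ≈⟨ *-congˡ (∑-C-rising x n j j<n) ⟩
      ι (g (suc j)) ⊗ (ι (j ! * (n C suc j)) ⊗ rising (x ⊕ ι (suc j)) (n ∸ suc j))
        ≈⟨ sym (ι-*-assoc (g (suc j)) (j !) (n C suc j) _) ⟩
      ι (g (suc j) * j ! * (n C suc j)) ⊗ rising (x ⊕ ι (suc j)) (n ∸ suc j) ∎

module Committees where

  open import Data.Bool using (_∧_; _∨_; T)
  open import Data.Nat using (_≟_)
  open import Data.Unit using (tt)
  open import Data.Product using (_×_; _,_; proj₁; proj₂)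
  open import Data.Vec using (Vec; []; _∷_; here; there)
  open import Data.Fin using (Fin; zero; suc)
  open import Data.Fin.Subset using (Subset; _∈_; ∣_∣; ⊥; _∪_; ⋃)
  open import Data.Fin.Subset.Properties using (_∈?_; nonempty?; drop-there)
  open import Data.List using (length; tabulate; allFin)
  open import Data.List.Properties using (map-tabulate)
  import Data.Fin.Properties as Fin
  open import Relation.Nullary.Decidable using (does-⇔; T?; _×-dec_)
  open import Function.Bundles using (mk⇔)
  open import Defs using (Placement; subsets; placements; validPlacement?; configs; chairSets; allOccupied?; F; S)
  open ℕΣ
  open Poly ℕ.+-*-commutativeSemiring using (sumR)
  open ≡ using (refl; cong; cong₂; trans; sym)
  open ≡.≡-Reasoning

  length≡∑∈1 : ∀ {a} {A : Set a} (xs : List A) → length xs ≡ ∑∈ xs (λ _ → 1)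
  length≡∑∈1 []       = refl
  length≡∑∈1 (x ∷ xs) = cong suc (length≡∑∈1 xs)

  ∑∈-allFin-suc : ∀ k (f : Fin (suc k) → ℕ) → ∑∈ (allFin (suc k)) f ≡ f zero + ∑∈ (allFin k) (f ∘ suc)
  ∑∈-allFin-suc k f = cong (f zero +_) (trans (cong sumR (map-tabulate suc f)) (sym (cong sumR (map-tabulate (λ i → i) (f ∘ suc)))))

  ∑∈-allFin-∈ : ∀ {k} (X : Subset k) y → ∑∈ (allFin k) (λ c → when (does (c ∈? X)) y) ≡ ∣ X ∣ * y
  ∑∈-allFin-∈ []          y = refl
  ∑∈-allFin-∈ (true ∷ X)  y = trans (∑∈-allFin-suc _ (λ c → when (does (c ∈? true ∷ X)) y)) (cong (y +_) (∑∈-allFin-∈ X y))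
  ∑∈-allFin-∈ (false ∷ X) y = trans (∑∈-allFin-suc _ (λ c → when (does (c ∈? false ∷ X)) y)) (∑∈-allFin-∈ X y)

  seatable : ∀ {r} → Subset r → ℕ → Bool
  seatable A a = does (nonempty? A) ∧ does (∣ A ∣ ≟ a)

  -- placements of a species with r representatives on a given set of a chairs: a set A of a
  -- representatives, and one of the a chairs for its eldest member
  placementsOn : ℕ → ℕ → ℕ
  placementsOn r a = ∑∈ (subsets r) (λ A → when (seatable A a) a)

  ∑-eldestChair : ∀ {k r} (u : Subset k → ℕ) (A : Subset r) (X : Subset k) →
    ∑∈ (map (λ c → (A , X , c)) (allFin k)) (λ p → when (does (validPlacement? p)) (u (proj₁ (proj₂ p))))
    ≡ when (seatable A ∣ X ∣) (∣ X ∣ * u X)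
  ∑-eldestChair {k} u A X = begin
    ∑∈ (map (λ c → (A , X , c)) (allFin k)) (λ p → when (does (validPlacement? p)) (u (proj₁ (proj₂ p))))
      ≡⟨ ∑∈-map (λ c → (A , X , c)) (allFin k) _ ⟩
    ∑∈ (allFin k) (λ c → when (does (nonempty? A) ∧ (does (∣ A ∣ ≟ ∣ X ∣) ∧ does (c ∈? X))) (u X))
      ≡⟨ ∑∈-cong (allFin k) (λ c → when-∧∧ (does (nonempty? A)) (does (∣ A ∣ ≟ ∣ X ∣)) (does (c ∈? X))) ⟩
    ∑∈ (allFin k) (λ c → when (seatable A ∣ X ∣) (when (does (c ∈? X)) (u X)))
      ≡⟨ ∑∈-when (seatable A ∣ X ∣) (allFin k) (λ c → when (does (c ∈? X)) (u X)) ⟩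
    when (seatable A ∣ X ∣) (∑∈ (allFin k) (λ c → when (does (c ∈? X)) (u X)))
      ≡⟨ cong (when (seatable A ∣ X ∣)) (∑∈-allFin-∈ X (u X)) ⟩
    when (seatable A ∣ X ∣) (∣ X ∣ * u X) ∎
    where
    when-∧∧ : ∀ a b c → when (a ∧ (b ∧ c)) (u X) ≡ when (a ∧ b) (when c (u X))
    when-∧∧ true true  c = refl
    when-∧∧ true false c = refl
    when-∧∧ false b    c = refl

  ∑-placements : ∀ k r (u : Subset k → ℕ) →
                 ∑∈ (placements k r) (λ p → u (proj₁ (proj₂ p))) ≡ ∑∈ (subsets k) (λ X → placementsOn r ∣ X ∣ * u X)
  ∑-placements k r u = begin
    ∑∈ (placements k r) (λ p → u (proj₁ (proj₂ p)))
      ≡⟨ ∑∈-filter validPlacement? candidates (λ p → u (proj₁ (proj₂ p))) ⟩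
    ∑∈ candidates (λ p → when (does (validPlacement? p)) (u (proj₁ (proj₂ p))))
      ≡⟨ ∑∈-concatMap (λ A → concatMap (λ X → map (λ c → (A , X , c)) (allFin k)) (subsets k)) (subsets r) _ ⟩
    ∑∈ (subsets r) (λ A → ∑∈ (concatMap (λ X → map (λ c → (A , X , c)) (allFin k)) (subsets k))
                             (λ p → when (does (validPlacement? p)) (u (proj₁ (proj₂ p)))))
      ≡⟨ ∑∈-cong (subsets r) (λ A → trans (∑∈-concatMap (λ X → map (λ c → (A , X , c)) (allFin k)) (subsets k) _)
                                          (∑∈-cong (subsets k) (∑-eldestChair u A))) ⟩
    ∑∈ (subsets r) (λ A → ∑∈ (subsets k) (λ X → when (seatable A ∣ X ∣) (∣ X ∣ * u X)))
      ≡⟨ ∑∈-comm (subsets r) (subsets k) (λ A X → when (seatable A ∣ X ∣) (∣ X ∣ * u X)) ⟩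
    ∑∈ (subsets k) (λ X → ∑∈ (subsets r) (λ A → when (seatable A ∣ X ∣) (∣ X ∣ * u X)))
      ≡⟨ ∑∈-cong (subsets k) (λ X → trans (∑∈-cong (subsets r) (λ A → sym (when-*ʳ (seatable A ∣ X ∣) (u X) ∣ X ∣)))
                                          (sym (∑∈-*ʳ (subsets r) (u X) (λ A → when (seatable A ∣ X ∣) ∣ X ∣)))) ⟩
    ∑∈ (subsets k) (λ X → placementsOn r ∣ X ∣ * u X) ∎
    where
    candidates : List (Placement k r)
    candidates = concatMap (λ A → concatMap (λ X → map (λ c → (A , X , c)) (allFin k)) (subsets k)) (subsets r)

  weights : ∀ {m} → Vec ℕ m → List (ℕ → ℕ)
  weights []       = []
  weights (r ∷ rs) = placementsOn r ∷ weights rs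

  -- Σ over chair sets X₁ … Xₘ of φ₁ ∣X₁∣ ⋯ φₘ ∣Xₘ∣ · u (X₁ ∪ ⋯ ∪ Xₘ)
  chairSum : ∀ k → List (ℕ → ℕ) → (Subset k → ℕ) → ℕ
  chairSum k []      u = u ⊥
  chairSum k (φ ∷ Φ) u = ∑∈ (subsets k) (λ X → φ ∣ X ∣ * chairSum k Φ (λ U → u (X ∪ U)))

  chairSum-cong : ∀ k Φ {u v : Subset k → ℕ} → (∀ U → u U ≡ v U) → chairSum k Φ u ≡ chairSum k Φ v
  chairSum-cong k []      u≡v = u≡v ⊥
  chairSum-cong k (φ ∷ Φ) u≡v = ∑∈-cong (subsets k) (λ X → cong (φ ∣ X ∣ *_) (chairSum-cong k Φ (λ U → u≡v (X ∪ U))))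

  chairSum-zero : ∀ k Φ → chairSum k Φ (λ _ → 0) ≡ 0
  chairSum-zero k []      = refl
  chairSum-zero k (φ ∷ Φ) = trans (∑∈-cong (subsets k) (λ X → trans (cong (φ ∣ X ∣ *_) (chairSum-zero k Φ)) (ℕ.*-zeroʳ (φ ∣ X ∣))))
                                  (∑∈-zero (subsets k))

  chairSum-when : ∀ k Φ b (u : Subset k → ℕ) → chairSum k Φ (λ U → when b (u U)) ≡ when b (chairSum k Φ u)
  chairSum-when k Φ true  u = refl
  chairSum-when k Φ false u = chairSum-zero k Φ

  ∑-configs : ∀ k {m} (rs : Vec ℕ m) (u : Subset k → ℕ) →
              ∑∈ (configs k rs) (λ cfg → u (⋃ (chairSets rs cfg))) ≡ chairSum k (weights rs) u
  ∑-configs k []       u = ℕ.+-identityʳ (u ⊥)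
  ∑-configs k (r ∷ rs) u = begin
    ∑∈ (concatMap (λ p → map (p ,_) (configs k rs)) (placements k r)) (λ cfg → u (⋃ (chairSets (r ∷ rs) cfg)))
      ≡⟨ ∑∈-concatMap (λ p → map (p ,_) (configs k rs)) (placements k r) _ ⟩
    ∑∈ (placements k r) (λ p → ∑∈ (map (p ,_) (configs k rs)) (λ cfg → u (⋃ (chairSets (r ∷ rs) cfg))))
      ≡⟨ ∑∈-cong (placements k r) (λ p → trans (∑∈-map (p ,_) (configs k rs) _)
                                                (∑-configs k rs (λ U → u (proj₁ (proj₂ p) ∪ U)))) ⟩
    ∑∈ (placements k r) (λ p → chairSum k (weights rs) (λ U → u (proj₁ (proj₂ p) ∪ U)))
      ≡⟨ ∑-placements k r (λ X → chairSum k (weights rs) (λ U → u (X ∪ U))) ⟩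
    chairSum k (weights (r ∷ rs)) u ∎

  isFullᵇ : ∀ {k} → Subset k → Bool
  isFullᵇ U = does (Fin.all? (λ j → j ∈? U))

  full : ∀ {k} → Subset k → ℕ
  full U = when (isFullᵇ U) 1

  F≡chairSum : ∀ k {m} (rs : Vec ℕ m) → F k rs ≡ chairSum k (weights rs) (λ _ → 1)
  F≡chairSum k rs = trans (length≡∑∈1 (configs k rs)) (∑-configs k rs (λ _ → 1))

  S≡chairSum : ∀ k {m} (rs : Vec ℕ m) → S k rs ≡ chairSum k (weights rs) full
  S≡chairSum k rs = begin
    S k rs                                                        ≡⟨ length≡∑∈1 (filter (allOccupied? rs) (configs k rs)) ⟩
    ∑∈ (filter (allOccupied? rs) (configs k rs)) (λ _ → 1)        ≡⟨ ∑∈-filter (allOccupied? rs) (configs k rs) (λ _ → 1) ⟩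
    ∑∈ (configs k rs) (λ cfg → full (⋃ (chairSets rs cfg)))        ≡⟨ ∑-configs k rs full ⟩
    chairSum k (weights rs) full                                  ∎

  anyᵇ : ∀ {m} → Subset m → Bool
  anyᵇ []      = false
  anyᵇ (b ∷ v) = b ∨ anyᵇ v

  -- the weights seen on chairs 1 … k when the species in v also occupy chair 0
  weightsOnRest : (Φ : List (ℕ → ℕ)) → Subset (length Φ) → List (ℕ → ℕ)
  weightsOnRest []      []      = []
  weightsOnRest (φ ∷ Φ) (b ∷ v) = (if b then φ ∘ suc else φ) ∷ weightsOnRest Φ v

  weightsOnRest-⊥ : ∀ Φ → weightsOnRest Φ ⊥ ≡ Φ
  weightsOnRest-⊥ []      = refl
  weightsOnRest-⊥ (φ ∷ Φ) = cong (φ ∷_) (weightsOnRest-⊥ Φ)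

  ∑-subsets-suc : ∀ n (f : Subset (suc n) → ℕ) →
                  ∑∈ (subsets (suc n)) f ≡ ∑∈ (true ∷ false ∷ []) (λ b → ∑∈ (subsets n) (λ v → f (b ∷ v)))
  ∑-subsets-suc n f = trans (∑∈-concatMap (λ b → map (b ∷_) (subsets n)) (true ∷ false ∷ []) f)
                            (∑∈-cong (true ∷ false ∷ []) (λ b → ∑∈-map (b ∷_) (subsets n) f))

  ∑-subsets-⊥ : ∀ n (f : Subset n → ℕ) → ∑∈ (subsets n) f ≡ f ⊥ + ∑∈ (subsets n) (λ v → when (anyᵇ v) (f v))
  ∑-subsets-⊥ zero    f = refl
  ∑-subsets-⊥ (suc n) f = begin
    ∑∈ (subsets (suc n)) f
      ≡⟨ ∑-subsets-suc n f ⟩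
    ∑∈ (subsets n) (λ v → f (true ∷ v)) + (∑∈ (subsets n) (λ v → f (false ∷ v)) + 0)
      ≡⟨ cong (λ t → ∑∈ (subsets n) (λ v → f (true ∷ v)) + (t + 0)) (∑-subsets-⊥ n (λ v → f (false ∷ v))) ⟩
    a + ((f ⊥ + b) + 0)
      ≡⟨ solve 3 (λ a f b → a :+ ((f :+ b) :+ con 0) := f :+ (a :+ (b :+ con 0))) refl a (f ⊥) b ⟩
    f ⊥ + (a + (b + 0))
      ≡⟨ cong (f ⊥ +_) (sym (∑-subsets-suc n (λ v → when (anyᵇ v) (f v)))) ⟩
    f ⊥ + ∑∈ (subsets (suc n)) (λ v → when (anyᵇ v) (f v)) ∎
    where
    open +-*-Solver
    a b : ℕ
    a = ∑∈ (subsets n) (λ v → f (true ∷ v))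
    b = ∑∈ (subsets n) (λ v → when (anyᵇ v) (f (false ∷ v)))

  chairSum-firstChair : ∀ k Φ (u : Subset (suc k) → ℕ) →
    chairSum (suc k) Φ u ≡ ∑∈ (subsets (length Φ)) (λ v → chairSum k (weightsOnRest Φ v) (λ U → u (anyᵇ v ∷ U)))
  chairSum-firstChair k []      u = sym (ℕ.+-identityʳ (u ⊥))
  chairSum-firstChair k (φ ∷ Φ) u = begin
    ∑∈ (subsets (suc k)) (λ X → φ ∣ X ∣ * chairSum (suc k) Φ (λ U → u (X ∪ U)))
      ≡⟨ ∑-subsets-suc k _ ⟩
    ∑∈ (true ∷ false ∷ []) (λ b → ∑∈ (subsets k) (λ X → φ ∣ b ∷ X ∣ * chairSum (suc k) Φ (λ U → u ((b ∷ X) ∪ U))))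
      ≡⟨ ∑∈-cong (true ∷ false ∷ []) column ⟩
    ∑∈ (true ∷ false ∷ []) (λ b → ∑∈ (subsets (length Φ)) (λ v → chairSum k (weightsOnRest (φ ∷ Φ) (b ∷ v)) (λ U → u (anyᵇ (b ∷ v) ∷ U))))
      ≡⟨ sym (∑-subsets-suc (length Φ) _) ⟩
    ∑∈ (subsets (suc (length Φ))) (λ v → chairSum k (weightsOnRest (φ ∷ Φ) v) (λ U → u (anyᵇ v ∷ U))) ∎
    where
    φ-∷ : ∀ b (X : Subset k) → φ ∣ b ∷ X ∣ ≡ (if b then φ ∘ suc else φ) ∣ X ∣
    φ-∷ true  X = refl
    φ-∷ false X = refl
    column : ∀ b → ∑∈ (subsets k) (λ X → φ ∣ b ∷ X ∣ * chairSum (suc k) Φ (λ U → u ((b ∷ X) ∪ U)))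
                 ≡ ∑∈ (subsets (length Φ)) (λ v → chairSum k (weightsOnRest (φ ∷ Φ) (b ∷ v)) (λ U → u ((b ∨ anyᵇ v) ∷ U)))
    column b = begin
      ∑∈ (subsets k) (λ X → φ ∣ b ∷ X ∣ * chairSum (suc k) Φ (λ U → u ((b ∷ X) ∪ U)))
        ≡⟨ ∑∈-cong (subsets k) (λ X → cong₂ _*_ (φ-∷ b X) (chairSum-firstChair k Φ (λ U → u ((b ∷ X) ∪ U)))) ⟩
      ∑∈ (subsets k) (λ X → φb ∣ X ∣ * ∑∈ (subsets (length Φ)) (λ v → rest X v))
        ≡⟨ ∑∈-cong (subsets k) (λ X → ∑∈-*ˡ (subsets (length Φ)) (φb ∣ X ∣) (rest X)) ⟩
      ∑∈ (subsets k) (λ X → ∑∈ (subsets (length Φ)) (λ v → φb ∣ X ∣ * rest X v))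
        ≡⟨ ∑∈-comm (subsets k) (subsets (length Φ)) (λ X v → φb ∣ X ∣ * rest X v) ⟩
      ∑∈ (subsets (length Φ)) (λ v → chairSum k (φb ∷ weightsOnRest Φ v) (λ U → u ((b ∨ anyᵇ v) ∷ U))) ∎
      where
      φb : ℕ → ℕ
      φb = if b then φ ∘ suc else φ
      rest : Subset k → Subset (length Φ) → ℕ
      rest X v = chairSum k (weightsOnRest Φ v) (λ U → u ((b ∨ anyᵇ v) ∷ (X ∪ U)))

  isFullᵇ-∷ : ∀ {k} b (U : Subset k) → isFullᵇ (b ∷ U) ≡ b ∧ isFullᵇ U
  isFullᵇ-∷ b U = does-⇔ (mk⇔ split join) (Fin.all? (λ j → j ∈? b ∷ U)) (T? b ×-dec Fin.all? (λ j → j ∈? U))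
    where
    head∈ : ∀ {b} → zero ∈ b ∷ U → T b
    head∈ here = tt
    split : ∀ {b} → (∀ j → j ∈ b ∷ U) → T b × (∀ j → j ∈ U)
    split all∈ = head∈ (all∈ zero) , (λ j → drop-there (all∈ (suc j)))
    join : ∀ {b} → T b × (∀ j → j ∈ U) → ∀ j → j ∈ b ∷ U
    join {true} _          zero    = here
    join        (_ , all∈) (suc j) = there (all∈ j)

  full-∷ : ∀ {k} b (U : Subset k) → full (b ∷ U) ≡ when b (full U)
  full-∷ b U with isFullᵇ (b ∷ U) | isFullᵇ-∷ b U
  full-∷ true  U | _ | refl = refl
  full-∷ false U | _ | refl = refl

  chairSum-full-suc : ∀ j Φ → chairSum (suc j) Φ full ≡ ∑∈ (subsets (length Φ)) (λ v → when (anyᵇ v) (chairSum j (weightsOnRest Φ v) full))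
  chairSum-full-suc j Φ = trans (chairSum-firstChair j Φ full) (∑∈-cong (subsets (length Φ)) (λ v →
    trans (chairSum-cong j (weightsOnRest Φ v) (full-∷ (anyᵇ v))) (chairSum-when j (weightsOnRest Φ v) (anyᵇ v) full)))

  ∑-weightsOnRest : ∀ j Φ → ∑∈ (subsets (length Φ)) (λ v → chairSum j (weightsOnRest Φ v) full)
                            ≡ chairSum j Φ full + chairSum (suc j) Φ full
  ∑-weightsOnRest j Φ = begin
    ∑∈ (subsets (length Φ)) (λ v → chairSum j (weightsOnRest Φ v) full)
      ≡⟨ ∑-subsets-⊥ (length Φ) (λ v → chairSum j (weightsOnRest Φ v) full) ⟩
    chairSum j (weightsOnRest Φ ⊥) full + ∑∈ (subsets (length Φ)) (λ v → when (anyᵇ v) (chairSum j (weightsOnRest Φ v) full))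
      ≡⟨ cong₂ _+_ (cong (λ Ψ → chairSum j Ψ full) (weightsOnRest-⊥ Φ)) (sym (chairSum-full-suc j Φ)) ⟩
    chairSum j Φ full + chairSum (suc j) Φ full ∎

  private
    ∑<-pascal : ∀ N (w : ℕ → ℕ) → ∑< (suc (suc N)) (λ t → (suc N C t) * w t)
                                 ≡ ∑< (suc N) (λ t → (N C t) * w t) + ∑< (suc N) (λ t → (N C t) * w (suc t))
    ∑<-pascal N w = begin
      ∑< (suc (suc N)) (λ t → (suc N C t) * w t)
        ≡⟨ ∑<-cong (suc (suc N)) (λ t → cong (_* w t) (sym (ι≡id (suc N C t)))) ⟩
      ∑< (suc (suc N)) (λ t → ι (suc N C t) * w t)
        ≡⟨ ℕScalars.∑<-pascal N w ⟩
      ∑< (suc N) (λ t → ι (N C t) * w t) + ∑< (suc N) (λ t → ι (N C t) * w (suc t))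
        ≡⟨ cong₂ _+_ (∑<-cong (suc N) (λ t → cong (_* w t) (ι≡id (N C t))))
                     (∑<-cong (suc N) (λ t → cong (_* w (suc t)) (ι≡id (N C t)))) ⟩
      ∑< (suc N) (λ t → (N C t) * w t) + ∑< (suc N) (λ t → (N C t) * w (suc t)) ∎
      where
      module ℕScalars = Scalars ℕ.+-*-commutativeSemiring
      open Poly ℕ.+-*-commutativeSemiring using (ι)
      ι≡id : ∀ n → ι n ≡ n
      ι≡id zero    = refl
      ι≡id (suc n) = cong suc (ι≡id n)

  -- chair 0 is either free or occupied: the two terms of Pascal's rule
  chairSum-binomial : ∀ k Φ → chairSum k Φ (λ _ → 1) ≡ ∑< (suc k) (λ j → (k C j) * chairSum j Φ full)
  chairSum-binomial zero    Φ = sym (trans (ℕ.+-identityʳ _) (ℕ.*-identityˡ _))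
  chairSum-binomial (suc k) Φ = begin
    chairSum (suc k) Φ (λ _ → 1)
      ≡⟨ chairSum-firstChair k Φ (λ _ → 1) ⟩
    ∑∈ Vs (λ v → chairSum k (weightsOnRest Φ v) (λ _ → 1))
      ≡⟨ ∑∈-cong Vs (λ v → chairSum-binomial k (weightsOnRest Φ v)) ⟩
    ∑∈ Vs (λ v → ∑< (suc k) (λ j → (k C j) * chairSum j (weightsOnRest Φ v) full))
      ≡⟨ ∑∈-∑<-comm Vs (suc k) (λ v j → (k C j) * chairSum j (weightsOnRest Φ v) full) ⟩
    ∑< (suc k) (λ j → ∑∈ Vs (λ v → (k C j) * chairSum j (weightsOnRest Φ v) full))
      ≡⟨ ∑<-cong (suc k) (λ j → sym (∑∈-*ˡ Vs (k C j) (λ v → chairSum j (weightsOnRest Φ v) full))) ⟩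
    ∑< (suc k) (λ j → (k C j) * ∑∈ Vs (λ v → chairSum j (weightsOnRest Φ v) full))
      ≡⟨ ∑<-cong (suc k) (λ j → trans (cong ((k C j) *_) (∑-weightsOnRest j Φ)) (ℕ.*-distribˡ-+ (k C j) (chairSum j Φ full) (chairSum (suc j) Φ full))) ⟩
    ∑< (suc k) (λ j → (k C j) * chairSum j Φ full + (k C j) * chairSum (suc j) Φ full)
      ≡⟨ ∑<-+ (suc k) (λ j → (k C j) * chairSum j Φ full) (λ j → (k C j) * chairSum (suc j) Φ full) ⟩
    ∑< (suc k) (λ j → (k C j) * chairSum j Φ full) + ∑< (suc k) (λ j → (k C j) * chairSum (suc j) Φ full)
      ≡⟨ sym (∑<-pascal k (λ j → chairSum j Φ full)) ⟩
    ∑< (suc (suc k)) (λ j → (suc k C j) * chairSum j Φ full) ∎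
    where
    Vs : List (Subset (length Φ))
    Vs = subsets (length Φ)

  F≡∑CS : ∀ k {m} (rs : Vec ℕ m) → F k rs ≡ ∑< (suc k) (λ j → (k C j) * S j rs)
  F≡∑CS k rs = begin
    F k rs                                                      ≡⟨ F≡chairSum k rs ⟩
    chairSum k (weights rs) (λ _ → 1)                           ≡⟨ chairSum-binomial k (weights rs) ⟩
    ∑< (suc k) (λ j → (k C j) * chairSum j (weights rs) full)   ≡⟨ ∑<-cong (suc k) (λ j → cong ((k C j) *_) (sym (S≡chairSum j rs))) ⟩
    ∑< (suc k) (λ j → (k C j) * S j rs)                         ∎

  S-zero : ∀ {m} (rs : Vec ℕ (suc m)) → S 0 rs ≡ 0
  S-zero (r ∷ rs) = begin
    S 0 (r ∷ rs)                                                         ≡⟨ S≡chairSum 0 (r ∷ rs) ⟩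
    placementsOn r 0 * chairSum 0 (weights rs) (λ U → full ([] ∪ U)) + 0 ≡⟨ cong (λ t → t * _ + 0) no-placement ⟩
    0                                                                    ∎
    where
    no-placement : placementsOn r 0 ≡ 0
    no-placement = trans (∑∈-cong (subsets r) (λ A → when-0 (seatable A 0))) (∑∈-zero (subsets r))
      where
      when-0 : ∀ b → when b 0 ≡ 0
      when-0 true  = refl
      when-0 false = refl

module Partitions where

  open import Data.Bool using (_∧_; T)
  open import Data.Bool.Properties using (T-∧)
  open import Data.Nat using (_≟_; _^_; _≤ᵇ_; _≡ᵇ_; _≥_)
  open import Data.Nat.DivMod using (_/_; m*n/n≡m)
  open import Data.Nat.ListAction using (sum)
  open import Data.Sum using (inj₁; inj₂)
  open import Data.List using (replicate; length)
  open import Data.List.Properties using (filter-all; filter-none; filter-++; length-++; length-replicate)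
  open import Data.List.Relation.Unary.All as All using (All; []; _∷_)
  import Data.List.Relation.Unary.All.Properties as Allₚ
  open import Data.List.Relation.Unary.Linked as Linked using (Linked; []; [-]; _∷_)
  open import Function.Bundles using (mk⇔; Equivalence)
  open import Relation.Nullary.Decidable using (does-⇔; T?)
  open import Defs using (IsPartition; isPartition?; mult; zUpTo; z; permCount; zUpTo≢0)
  open ≡ using (refl; cong; cong₂; trans; sym; _≢_)
  open ≡.≡-Reasoning

  partitionᵇ : ℕ → ℕ → List ℕ → Bool
  partitionᵇ B s []      = s ≡ᵇ 0
  partitionᵇ B s (a ∷ μ) = (1 ≤ᵇ a) ∧ ((a ≤ᵇ B) ∧ ((a ≤ᵇ s) ∧ partitionᵇ a (s ∸ a) μ))

  private
    ∧-intro : ∀ {x y} → T x → T y → T (x ∧ y)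
    ∧-intro tx ty = Equivalence.from T-∧ (tx , ty)

    ∧-elim : ∀ {x y} → T (x ∧ y) → T x × T y
    ∧-elim = Equivalence.to T-∧

    bounded-by-sum : ∀ μ → All (_≤ sum μ) μ
    bounded-by-sum []      = []
    bounded-by-sum (a ∷ μ) = ℕ.m≤m+n a (sum μ) ∷ All.map (λ p → ℕ.≤-trans p (ℕ.m≤n+m (sum μ) a)) (bounded-by-sum μ)

    linked-bound : ∀ {a} μ → Linked _≥_ (a ∷ μ) → All (_≤ a) μ
    linked-bound []      _           = []
    linked-bound (b ∷ μ) (b≤a ∷ l) = b≤a ∷ All.map (λ p → ℕ.≤-trans p b≤a) (linked-bound μ l)

  partitionᵇ-complete : ∀ B s μ → All (1 ≤_) μ → Linked _≥_ μ → All (_≤ B) μ → sum μ ≡ s → T (partitionᵇ B s μ)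
  partitionᵇ-complete B s []      _          _ _          refl = _
  partitionᵇ-complete B s (a ∷ μ) (1≤a ∷ ps) l (a≤B ∷ _) Σ≡s =
    ∧-intro (ℕ.≤⇒≤ᵇ 1≤a) (∧-intro (ℕ.≤⇒≤ᵇ a≤B) (∧-intro (ℕ.≤⇒≤ᵇ a≤s)
      (partitionᵇ-complete a (s ∸ a) μ ps (Linked.tail l) (linked-bound μ l) Σμ≡s∸a)))
    where
    a≤s : a ≤ s
    a≤s = ≡.subst (a ≤_) Σ≡s (ℕ.m≤m+n a (sum μ))
    Σμ≡s∸a : sum μ ≡ s ∸ a
    Σμ≡s∸a = sym (trans (cong (_∸ a) (sym Σ≡s)) (ℕ.m+n∸m≡n a (sum μ)))

  partitionᵇ-sound : ∀ B s μ → T (partitionᵇ B s μ) → All (1 ≤_) μ × Linked _≥_ μ × All (_≤ B) μ × sum μ ≡ s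
  partitionᵇ-sound B s []      t = [] , [] , [] , sym (ℕ.≡ᵇ⇒≡ s 0 t)
  partitionᵇ-sound B s (a ∷ μ) t
    with (t1≤a , t′) ← ∧-elim t
    with (ta≤B , t″) ← ∧-elim t′
    with (ta≤s , tμ) ← ∧-elim t″
    with (ps , l , bnd , Σ≡) ← partitionᵇ-sound a (s ∸ a) μ tμ
    = (ℕ.≤ᵇ⇒≤ 1 a t1≤a ∷ ps) , cons bnd l , (a≤B ∷ All.map (λ p → ℕ.≤-trans p a≤B) bnd)
    , trans (cong (a +_) Σ≡) (ℕ.m+[n∸m]≡n (ℕ.≤ᵇ⇒≤ a s ta≤s))
    where
    a≤B : a ≤ B
    a≤B = ℕ.≤ᵇ⇒≤ a B ta≤B
    cons : ∀ {ν} → All (_≤ a) ν → Linked _≥_ ν → Linked _≥_ (a ∷ ν)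
    cons []        _ = [-]
    cons (b≤a ∷ _) l = b≤a ∷ l

  isPartition≡partitionᵇ : ∀ n μ → does (isPartition? n μ) ≡ partitionᵇ n n μ
  isPartition≡partitionᵇ n μ = does-⇔ (mk⇔ to from) (isPartition? n μ) (T? (partitionᵇ n n μ))
    where
    to : IsPartition n μ → T (partitionᵇ n n μ)
    to (ps , l , Σ≡n) = partitionᵇ-complete n n μ ps l (≡.subst (λ k → All (_≤ k) μ) Σ≡n (bounded-by-sum μ)) Σ≡n
    from : T (partitionᵇ n n μ) → IsPartition n μ
    from t with (ps , l , _ , Σ≡n) ← partitionᵇ-sound n n μ t = ps , l , Σ≡n

  mult-++ : ∀ i μ ν → mult i (μ ++ ν) ≡ mult i μ + mult i ν
  mult-++ i μ ν = trans (cong length (filter-++ (_≟ i) μ ν)) (length-++ (filter (_≟ i) μ))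

  mult-replicate : ∀ i m → mult i (replicate m i) ≡ m
  mult-replicate i m = trans (cong length (filter-all (_≟ i) (Allₚ.replicate⁺ m refl))) (length-replicate m)

  mult-absent : ∀ i μ → All (_≢ i) μ → mult i μ ≡ 0
  mult-absent i μ μ∌i = cong length (filter-none (_≟ i) μ∌i)

  zUpTo-cong : ∀ μ ν K → (∀ i → i ≤ K → mult i μ ≡ mult i ν) → zUpTo μ K ≡ zUpTo ν K
  zUpTo-cong μ ν zero    eq = refl
  zUpTo-cong μ ν (suc K) eq = cong₂ (λ m r → suc K ^ m * m ! * r) (eq (suc K) ℕ.≤-refl)
                                    (zUpTo-cong μ ν K (λ i i≤K → eq i (ℕ.m≤n⇒m≤1+n i≤K)))

  zUpTo-stable : ∀ μ {K} → All (_≤ K) μ → ∀ j → zUpTo μ (j + K) ≡ zUpTo μ K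
  zUpTo-stable μ     μ≤K zero    = refl
  zUpTo-stable μ {K} μ≤K (suc j) = begin
    suc (j + K) ^ mult (suc (j + K)) μ * (mult (suc (j + K)) μ) ! * zUpTo μ (j + K)
      ≡⟨ cong (λ m → suc (j + K) ^ m * m ! * zUpTo μ (j + K)) (mult-absent _ μ (All.map (λ a≤K → ℕ.<⇒≢ (s≤s (ℕ.≤-trans a≤K (ℕ.m≤n+m K j)))) μ≤K)) ⟩
    1 * 1 * zUpTo μ (j + K)
      ≡⟨ trans (ℕ.*-identityˡ _) (zUpTo-stable μ μ≤K j) ⟩
    zUpTo μ K ∎

  z≡zUpTo : ∀ μ K → All (_≤ K) μ → z μ ≡ zUpTo μ K
  z≡zUpTo μ K μ≤K with ℕ.≤-total K (sum μ)
  ... | inj₁ K≤Σ = trans (cong (zUpTo μ) (sym (ℕ.m∸n+n≡m K≤Σ))) (zUpTo-stable μ μ≤K (sum μ ∸ K))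
  ... | inj₂ Σ≤K = sym (trans (cong (zUpTo μ) (sym (ℕ.m∸n+n≡m Σ≤K))) (zUpTo-stable μ (bounded-by-sum μ) (K ∸ sum μ)))

  z-replicate++ : ∀ m B ν → All (_≤ B) ν → z (replicate m (suc B) ++ ν) ≡ suc B ^ m * m ! * z ν
  z-replicate++ m B ν ν≤B = begin
    z μ                                                ≡⟨ z≡zUpTo μ (suc B) μ≤1+B ⟩
    suc B ^ mult (suc B) μ * (mult (suc B) μ) ! * zUpTo μ B
      ≡⟨ cong₂ (λ k r → suc B ^ k * k ! * r) mult-top (zUpTo-cong μ ν B mult-below) ⟩
    suc B ^ m * m ! * zUpTo ν B                        ≡⟨ cong (suc B ^ m * m ! *_) (sym (z≡zUpTo ν B ν≤B)) ⟩
    suc B ^ m * m ! * z ν                              ∎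
    where
    μ : List ℕ
    μ = replicate m (suc B) ++ ν
    μ≤1+B : All (_≤ suc B) μ
    μ≤1+B = Allₚ.++⁺ (Allₚ.replicate⁺ m ℕ.≤-refl) (All.map ℕ.m≤n⇒m≤1+n ν≤B)
    ν∌ : ∀ {i} → B < i → All (_≢ i) ν
    ν∌ B<i = All.map (λ a≤B → ℕ.<⇒≢ (ℕ.≤-<-trans a≤B B<i)) ν≤B
    mult-top : mult (suc B) μ ≡ m
    mult-top = trans (mult-++ (suc B) (replicate m (suc B)) ν)
                     (trans (cong₂ _+_ (mult-replicate (suc B) m) (mult-absent (suc B) ν (ν∌ ℕ.≤-refl))) (ℕ.+-identityʳ m))
    mult-below : ∀ i → i ≤ B → mult i μ ≡ mult i ν
    mult-below i i≤B = trans (mult-++ i (replicate m (suc B)) ν)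
                             (cong (_+ mult i ν) (mult-absent i (replicate m (suc B)) (Allₚ.replicate⁺ m (λ 1+B≡i → ℕ.<⇒≢ (s≤s i≤B) (sym 1+B≡i)))))

  permCount-unique : ∀ n μ a → a * z μ ≡ n ! → permCount n μ ≡ a
  permCount-unique n μ a a*z≡n! = trans (cong (λ t → (t / z μ) {{zUpTo≢0 μ (sum μ)}}) (sym a*z≡n!))
                                        (m*n/n≡m a (z μ) {{zUpTo≢0 μ (sum μ)}})

  -- q B m = (m (B+1))! / ((B+1)^m m!), the number of permutations of m (B+1) points with m cycles of length B+1
  q : ℕ → ℕ → ℕ
  q B zero    = 1
  q B (suc m) = ((B + m * suc B) C B) * B ! * q B m

  q-factorials : ∀ B m → q B m * (suc B ^ m * m !) ≡ (m * suc B) !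
  q-factorials B zero    = refl
  q-factorials B (suc m) = begin
    ((B + m * suc B) C B) * B ! * q B m * (suc B * suc B ^ m * (suc m * m !))
      ≡⟨ solve 7 (λ X f Q b p sm mf → X :* f :* Q :* (b :* p :* (sm :* mf)) := X :* (f :* (Q :* (p :* mf))) :* (sm :* b)) refl
               ((B + m * suc B) C B) (B !) (q B m) (suc B) (suc B ^ m) (suc m) (m !) ⟩
    ((B + m * suc B) C B) * (B ! * (q B m * (suc B ^ m * m !))) * (suc m * suc B)
      ≡⟨ cong (λ t → ((B + m * suc B) C B) * (B ! * t) * (suc m * suc B)) (q-factorials B m) ⟩
    ((B + m * suc B) C B) * (B ! * (m * suc B) !) * (suc m * suc B)
      ≡⟨ cong (_* (suc m * suc B)) (C-factorials B (m * suc B)) ⟩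
    (B + m * suc B) ! * (suc m * suc B)
      ≡⟨ ℕ.*-comm _ (suc m * suc B) ⟩
    (suc m * suc B) ! ∎
    where open +-*-Solver

  q-absorb : ∀ B m → suc m * q B (suc m) ≡ ((suc m * suc B) C suc B) * B ! * q B m
  q-absorb B m = ℕ.*-cancelʳ-≡ _ _ (suc B ^ m * m ! * suc B) {{nz}} (begin
    suc m * q B (suc m) * (suc B ^ m * m ! * suc B)
      ≡⟨ solve 5 (λ sm Q p mf b → sm :* Q :* (p :* mf :* b) := Q :* (b :* p :* (sm :* mf))) refl
               (suc m) (q B (suc m)) (suc B ^ m) (m !) (suc B) ⟩
    q B (suc m) * (suc B ^ suc m * (suc m) !)
      ≡⟨ q-factorials B (suc m) ⟩
    (suc B + m * suc B) !
      ≡⟨ sym (C-factorials (suc B) (m * suc B)) ⟩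
    ((suc B + m * suc B) C suc B) * ((suc B) ! * (m * suc B) !)
      ≡⟨ cong (λ t → ((suc B + m * suc B) C suc B) * ((suc B) ! * t)) (sym (q-factorials B m)) ⟩
    ((suc B + m * suc B) C suc B) * (suc B * B ! * (q B m * (suc B ^ m * m !)))
      ≡⟨ solve 6 (λ X b f Q p mf → X :* (b :* f :* (Q :* (p :* mf))) := X :* f :* Q :* (p :* mf :* b)) refl
               ((suc B + m * suc B) C suc B) (suc B) (B !) (q B m) (suc B ^ m) (m !) ⟩
    ((suc m * suc B) C suc B) * B ! * q B m * (suc B ^ m * m ! * suc B) ∎)
    where
    open +-*-Solver
    nz : NonZero (suc B ^ m * m ! * suc B)
    nz = ℕ.m*n≢0 _ _ {{ℕ.m*n≢0 _ _ {{ℕ.m^n≢0 (suc B) m}} {{m ℕ.!≢0}}}}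

  q-through : ∀ s B m → (s C (B + m * suc B)) * q B (suc m) ≡ (s C B) * (((s ∸ B) C (m * suc B)) * q B m) * B !
  q-through s B m = begin
    (s C a′) * (((a′ C B) * B !) * q B m)   ≡⟨ solve 4 (λ c d f r → c :* (d :* f :* r) := c :* d :* f :* r) refl (s C a′) (a′ C B) (B !) (q B m) ⟩
    (s C a′) * (a′ C B) * B ! * q B m       ≡⟨ cong (λ t → t * B ! * q B m) (C-trinomial s B a) ⟩
    (s C B) * ((s ∸ B) C a) * B ! * q B m   ≡⟨ solve 4 (λ c d f r → c :* d :* f :* r := c :* (d :* r) :* f) refl (s C B) ((s ∸ B) C a) (B !) (q B m) ⟩
    (s C B) * (((s ∸ B) C a) * q B m) * B ! ∎
    where
    open +-*-Solver
    a a′ : ℕ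
    a = m * suc B
    a′ = B + a

  q-marked : ∀ s B m w → (s C (suc m * suc B)) * q B (suc m) * (suc m * w)
                         ≡ (s C suc B) * (((s ∸ suc B) C (m * suc B)) * q B m) * (w * B !)
  q-marked s B m w = begin
    (s C A) * q B (suc m) * (suc m * w)          ≡⟨ solve 4 (λ c r k t → c :* r :* (k :* t) := c :* (k :* r) :* t) refl (s C A) (q B (suc m)) (suc m) w ⟩
    (s C A) * (suc m * q B (suc m)) * w          ≡⟨ cong (λ t → (s C A) * t * w) (q-absorb B m) ⟩
    (s C A) * ((A C suc B) * B ! * q B m) * w    ≡⟨ solve 5 (λ c d f r t → c :* (d :* f :* r) :* t := c :* d :* f :* r :* t) refl (s C A) (A C suc B) (B !) (q B m) w ⟩
    (s C A) * (A C suc B) * B ! * q B m * w      ≡⟨ cong (λ t → t * B ! * q B m * w) (C-trinomial s (suc B) (m * suc B)) ⟩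
    (s C suc B) * ((s ∸ suc B) C (m * suc B)) * B ! * q B m * w
      ≡⟨ solve 5 (λ c d f r t → c :* d :* f :* r :* t := c :* (d :* r) :* (t :* f)) refl (s C suc B) ((s ∸ suc B) C (m * suc B)) (B !) (q B m) w ⟩
    (s C suc B) * (((s ∸ suc B) C (m * suc B)) * q B m) * (w * B !) ∎
    where
    open +-*-Solver
    A : ℕ
    A = suc m * suc B

  -- μ = (B)^{m_B} ⋯ (1)^{m_1}: a partition into parts at most B, listed by multiplicities
  data Grouped : ℕ → List ℕ → Set where
    []  : Grouped 0 []
    add : ∀ {B μ} m → Grouped B μ → Grouped (suc B) (replicate m (suc B) ++ μ)

  Grouped-bounded : ∀ {B μ} → Grouped B μ → All (_≤ B) μ
  Grouped-bounded []        = []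
  Grouped-bounded (add m g) = Allₚ.++⁺ (Allₚ.replicate⁺ m ℕ.≤-refl) (All.map ℕ.m≤n⇒m≤1+n (Grouped-bounded g))

  sum-replicate++ : ∀ m b ν → sum (replicate m b ++ ν) ≡ m * b + sum ν
  sum-replicate++ zero    b ν = refl
  sum-replicate++ (suc m) b ν = trans (cong (b +_) (sum-replicate++ m b ν)) (sym (ℕ.+-assoc b (m * b) (sum ν)))

  private
    -- choose which m (B+1) of the points lie on the (B+1)-cycles, then arrange both parts
    replicate++-factorials : ∀ m B ν → All (_≤ B) ν → permCount (sum ν) ν * z ν ≡ (sum ν) ! →
      ((m * suc B + sum ν) C (m * suc B)) * q B m * permCount (sum ν) ν * z (replicate m (suc B) ++ ν)
      ≡ (sum (replicate m (suc B) ++ ν)) !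
    replicate++-factorials m B ν ν≤B P*z≡ = begin
      X * q B m * P * z (replicate m (suc B) ++ ν)
        ≡⟨ cong (X * q B m * P *_) (z-replicate++ m B ν ν≤B) ⟩
      X * q B m * P * (suc B ^ m * m ! * z ν)
        ≡⟨ solve 6 (λ X Q P p f Z → X :* Q :* P :* (p :* f :* Z) := X :* (Q :* (p :* f)) :* (P :* Z)) refl
                 X (q B m) P (suc B ^ m) (m !) (z ν) ⟩
      X * (q B m * (suc B ^ m * m !)) * (P * z ν)
        ≡⟨ cong₂ (λ s t → X * s * t) (q-factorials B m) P*z≡ ⟩
      X * (m * suc B) ! * (sum ν) !
        ≡⟨ trans (ℕ.*-assoc X _ _) (C-factorials (m * suc B) (sum ν)) ⟩
      (m * suc B + sum ν) !
        ≡⟨ cong _! (sym (sum-replicate++ m (suc B) ν)) ⟩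
      (sum (replicate m (suc B) ++ ν)) ! ∎
      where
      open +-*-Solver
      X P : ℕ
      X = (m * suc B + sum ν) C (m * suc B)
      P = permCount (sum ν) ν

  permCount-factorials : ∀ {B μ} → Grouped B μ → permCount (sum μ) μ * z μ ≡ (sum μ) !
  permCount-factorials []                = refl
  permCount-factorials (add {B} {ν} m g) =
    trans (cong (_* z μ) (permCount-unique (sum μ) μ (((m * suc B + sum ν) C (m * suc B)) * q B m * permCount (sum ν) ν) factorials))
          factorials
    where
    μ : List ℕ
    μ = replicate m (suc B) ++ ν
    factorials : ((m * suc B + sum ν) C (m * suc B)) * q B m * permCount (sum ν) ν * z μ ≡ (sum μ) !
    factorials = replicate++-factorials m B ν (Grouped-bounded g) (permCount-factorials g)

  permCount-replicate++ : ∀ {B ν} m → Grouped B ν →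
    permCount (sum (replicate m (suc B) ++ ν)) (replicate m (suc B) ++ ν)
    ≡ ((m * suc B + sum ν) C (m * suc B)) * q B m * permCount (sum ν) ν
  permCount-replicate++ {B} {ν} m g =
    permCount-unique (sum μ) μ _ (replicate++-factorials m B ν (Grouped-bounded g) (permCount-factorials g))
    where
    μ : List ℕ
    μ = replicate m (suc B) ++ ν

module PartitionSums {c ℓ} (R : CommutativeSemiring c ℓ) where

  open CommutativeSemiring R renaming (_+_ to _⊕_; _*_ to _⊗_)
  open import Data.Bool using (_∧_)
  open import Data.Bool.Properties using (T-≡)
  open import Data.Nat using (_≤ᵇ_; _≡ᵇ_)
  open import Data.Nat.ListAction using (sum)
  open import Data.List using (replicate)
  open import Relation.Nullary.Decidable using (dec-true; dec-false; does-⇔)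
  open import Function.Bundles using (mk⇔; Equivalence)
  open import Defs using (listsOfLength; candidates; partitions; isPartition?)
  open Sums R
  open Partitions
  open import Relation.Binary.Reasoning.Setoid setoid

  ≤ᵇ-true : ∀ {m n} → m ≤ n → (m ≤ᵇ n) ≡ true
  ≤ᵇ-true {m} {n} = dec-true (m ℕ.≤? n)

  ≤ᵇ-false : ∀ {m n} → n < m → (m ≤ᵇ n) ≡ false
  ≤ᵇ-false {m} {n} n<m = dec-false (m ℕ.≤? n) (ℕ.<⇒≱ n<m)

  ≤ᵇ-sound : ∀ {m n} → (m ≤ᵇ n) ≡ true → m ≤ n
  ≤ᵇ-sound {m} {n} m≤ᵇn = ℕ.≤ᵇ⇒≤ m n (Equivalence.from T-≡ m≤ᵇn)

  when-≤ᵇ : ∀ {m n} y → m ≤ n → when (m ≤ᵇ n) y ≈ y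
  when-≤ᵇ y m≤n = reflexive (≡.cong (λ b → when b y) (≤ᵇ-true m≤n))

  when-≰ᵇ : ∀ {m n} y → n < m → when (m ≤ᵇ n) y ≈ 0#
  when-≰ᵇ y n<m = reflexive (≡.cong (λ b → when b y) (≤ᵇ-false n<m))

  -- Σ g μ over the partitions μ of s into fewer than `fuel` parts, all at most B, split by the first part
  byFirstPart : ℕ → ℕ → ℕ → (List ℕ → Carrier) → Carrier
  byFirstPart zero       B s g = 0#
  byFirstPart (suc fuel) B s g =
    when (s ≡ᵇ 0) (g []) ⊕ ∑< B (λ a → when (suc a ≤ᵇ s) (byFirstPart fuel (suc a) (s ∸ suc a) (λ μ → g (suc a ∷ μ))))

  -- Σ g μ over the partitions μ of s into parts at most B, split by the multiplicity of the part B
  byMultiplicity : ℕ → ℕ → (List ℕ → Carrier) → Carrier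
  byMultiplicity zero    s g = when (s ≡ᵇ 0) (g [])
  byMultiplicity (suc B) s g =
    ∑< (suc s) (λ m → when (m * suc B ≤ᵇ s) (byMultiplicity B (s ∸ m * suc B) (λ μ → g (replicate m (suc B) ++ μ))))

  module _ (N : ℕ) where

    private
      ofLength : ℕ → ℕ → ℕ → (List ℕ → Carrier) → Carrier
      ofLength l B s g = ∑∈ (listsOfLength N l) (λ μ → when (partitionᵇ B s μ) (g μ))

      firstPartOk : ℕ → ℕ → ℕ → Bool
      firstPartOk B s a = (1 ≤ᵇ a) ∧ ((a ≤ᵇ B) ∧ (a ≤ᵇ s))

      when-∧∧∧ : ∀ a b c d y → when (a ∧ (b ∧ (c ∧ d))) y ≈ when (a ∧ (b ∧ c)) (when d y)
      when-∧∧∧ true true  true  d y = refl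
      when-∧∧∧ true true  false d y = refl
      when-∧∧∧ true false c     d y = refl
      when-∧∧∧ false b    c     d y = refl

      ofLength-suc : ∀ l B s (g : List ℕ → Carrier) →
        ofLength (suc l) B s g ≈ ∑< (suc N) (λ a → when (firstPartOk B s a) (ofLength l a (s ∸ a) (λ μ → g (a ∷ μ))))
      ofLength-suc l B s g = begin
        ∑∈ (concatMap (λ a → map (a ∷_) (listsOfLength N l)) (upTo (suc N))) G
          ≈⟨ ∑∈-concatMap (λ a → map (a ∷_) (listsOfLength N l)) (upTo (suc N)) G ⟩
        ∑∈ (upTo (suc N)) (λ a → ∑∈ (map (a ∷_) (listsOfLength N l)) G)
          ≈⟨ ∑∈-applyUpTo (λ a → a) (suc N) (λ a → ∑∈ (map (a ∷_) (listsOfLength N l)) G) ⟩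
        ∑< (suc N) (λ a → ∑∈ (map (a ∷_) (listsOfLength N l)) G)
          ≈⟨ ∑<-cong (suc N) (λ a → begin
               ∑∈ (map (a ∷_) (listsOfLength N l)) G
                 ≈⟨ ∑∈-map (a ∷_) (listsOfLength N l) G ⟩
               ∑∈ (listsOfLength N l) (λ μ → G (a ∷ μ))
                 ≈⟨ ∑∈-cong (listsOfLength N l) (λ μ → when-∧∧∧ (1 ≤ᵇ a) (a ≤ᵇ B) (a ≤ᵇ s) (partitionᵇ a (s ∸ a) μ) (g (a ∷ μ))) ⟩
               ∑∈ (listsOfLength N l) (λ μ → when (firstPartOk B s a) (when (partitionᵇ a (s ∸ a) μ) (g (a ∷ μ))))
                 ≈⟨ ∑∈-when (firstPartOk B s a) (listsOfLength N l) (λ μ → when (partitionᵇ a (s ∸ a) μ) (g (a ∷ μ))) ⟩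
               when (firstPartOk B s a) (ofLength l a (s ∸ a) (λ μ → g (a ∷ μ))) ∎) ⟩
        ∑< (suc N) (λ a → when (firstPartOk B s a) (ofLength l a (s ∸ a) (λ μ → g (a ∷ μ)))) ∎
        where
        G : List ℕ → Carrier
        G μ = when (partitionᵇ B s μ) (g μ)

      firstPart-range : ∀ B s (Y : ℕ → Carrier) → B ≤ N →
        ∑< (suc N) (λ a → when (firstPartOk B s a) (Y a)) ≈ ∑< B (λ a → when (suc a ≤ᵇ s) (Y (suc a)))
      firstPart-range B s Y B≤N = begin
        0# ⊕ ∑< N (λ a → when (firstPartOk B s (suc a)) (Y (suc a)))
          ≈⟨ +-identityˡ _ ⟩
        ∑< N (λ a → when (firstPartOk B s (suc a)) (Y (suc a)))
          ≈⟨ ∑<-truncate (λ a → when (firstPartOk B s (suc a)) (Y (suc a))) B≤N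
               (λ a B≤a → reflexive (≡.cong (λ b → when (b ∧ (suc a ≤ᵇ s)) (Y (suc a))) (≤ᵇ-false (s≤s B≤a)))) ⟩
        ∑< B (λ a → when (firstPartOk B s (suc a)) (Y (suc a)))
          ≈⟨ ∑<-congᵇ B (λ a a<B → reflexive (≡.cong (λ b → when (b ∧ (suc a ≤ᵇ s)) (Y (suc a))) (≤ᵇ-true a<B))) ⟩
        ∑< B (λ a → when (suc a ≤ᵇ s) (Y (suc a))) ∎

      ofLength-byFirstPart : ∀ fuel B s (g : List ℕ → Carrier) → B ≤ N → ∑< fuel (λ l → ofLength l B s g) ≈ byFirstPart fuel B s g
      ofLength-byFirstPart zero       B s g B≤N = refl
      ofLength-byFirstPart (suc fuel) B s g B≤N = +-cong (+-identityʳ _) (begin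
        ∑< fuel (λ l → ofLength (suc l) B s g)
          ≈⟨ ∑<-cong fuel (λ l → ofLength-suc l B s g) ⟩
        ∑< fuel (λ l → ∑< (suc N) (λ a → when (firstPartOk B s a) (ofLength l a (s ∸ a) (λ μ → g (a ∷ μ)))))
          ≈⟨ ∑<-comm fuel (suc N) (λ l a → when (firstPartOk B s a) (ofLength l a (s ∸ a) (λ μ → g (a ∷ μ)))) ⟩
        ∑< (suc N) (λ a → ∑< fuel (λ l → when (firstPartOk B s a) (ofLength l a (s ∸ a) (λ μ → g (a ∷ μ)))))
          ≈⟨ ∑<-congᵇ (suc N) (λ a a<1+N → trans (∑<-when (firstPartOk B s a) fuel (λ l → ofLength l a (s ∸ a) (λ μ → g (a ∷ μ))))
               (when-cong (firstPartOk B s a) (λ _ → ofLength-byFirstPart fuel a (s ∸ a) (λ μ → g (a ∷ μ)) (ℕ.≤-pred a<1+N)))) ⟩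
        ∑< (suc N) (λ a → when (firstPartOk B s a) (byFirstPart fuel a (s ∸ a) (λ μ → g (a ∷ μ))))
          ≈⟨ firstPart-range B s (λ a → byFirstPart fuel a (s ∸ a) (λ μ → g (a ∷ μ))) B≤N ⟩
        ∑< B (λ a → when (suc a ≤ᵇ s) (byFirstPart fuel (suc a) (s ∸ suc a) (λ μ → g (suc a ∷ μ)))) ∎)

    ∑-partitions : ∀ (g : List ℕ → Carrier) → ∑∈ (partitions N) g ≈ byFirstPart (suc N) N N g
    ∑-partitions g = begin
      ∑∈ (partitions N) g
        ≈⟨ ∑∈-filter (isPartition? N) (candidates N) g ⟩
      ∑∈ (candidates N) (λ μ → when (does (isPartition? N μ)) (g μ))
        ≈⟨ ∑∈-cong (candidates N) (λ μ → reflexive (≡.cong (λ b → when b (g μ)) (isPartition≡partitionᵇ N μ))) ⟩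
      ∑∈ (concatMap (listsOfLength N) (upTo (suc N))) (λ μ → when (partitionᵇ N N μ) (g μ))
        ≈⟨ ∑∈-concatMap (listsOfLength N) (upTo (suc N)) (λ μ → when (partitionᵇ N N μ) (g μ)) ⟩
      ∑∈ (upTo (suc N)) (λ l → ofLength l N N g)
        ≈⟨ ∑∈-applyUpTo (λ l → l) (suc N) (λ l → ofLength l N N g) ⟩
      ∑< (suc N) (λ l → ofLength l N N g)
        ≈⟨ ofLength-byFirstPart (suc N) N N g ℕ.≤-refl ⟩
      byFirstPart (suc N) N N g ∎

  byFirstPart-suc : ∀ fuel B s (g : List ℕ → Carrier) → byFirstPart (suc fuel) (suc B) s g
    ≈ byFirstPart (suc fuel) B s g ⊕ when (suc B ≤ᵇ s) (byFirstPart fuel (suc B) (s ∸ suc B) (λ μ → g (suc B ∷ μ)))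
  byFirstPart-suc fuel B s g =
    trans (+-congˡ (∑<-last B (λ a → when (suc a ≤ᵇ s) (byFirstPart fuel (suc a) (s ∸ suc a) (λ μ → g (suc a ∷ μ))))))
          (sym (+-assoc _ _ _))

  private
    positive-multiplicity : ∀ B s′ (g : List ℕ → Carrier) →
      ∑< (suc B + s′) (λ m → when (suc m * suc B ≤ᵇ suc B + s′)
                                  (byMultiplicity B (suc B + s′ ∸ suc m * suc B) (λ μ → g (replicate (suc m) (suc B) ++ μ))))
      ≈ byMultiplicity (suc B) s′ (λ μ → g (suc B ∷ μ))
    positive-multiplicity B s′ g = begin
      ∑< (suc B + s′) h
        ≈⟨ ∑<-truncate h (s≤s (ℕ.m≤n+m s′ B)) (λ m 1+s′≤m → when-≰ᵇ (tail m) (ℕ.+-monoʳ-< (suc B) (ℕ.<-≤-trans 1+s′≤m (ℕ.m≤m*n m (suc B))))) ⟩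
      ∑< (suc s′) h
        ≈⟨ ∑<-cong (suc s′) (λ m → reflexive (≡.cong₂ (λ b t → when b (byMultiplicity B t (λ μ → g (suc B ∷ replicate m (suc B) ++ μ))))
                                                        (shift-guard m) (ℕ.[m+n]∸[m+o]≡n∸o (suc B) s′ (m * suc B)))) ⟩
      byMultiplicity (suc B) s′ (λ μ → g (suc B ∷ μ)) ∎
      where
      tail : ℕ → Carrier
      tail m = byMultiplicity B (suc B + s′ ∸ suc m * suc B) (λ μ → g (replicate (suc m) (suc B) ++ μ))
      h : ℕ → Carrier
      h m = when (suc m * suc B ≤ᵇ suc B + s′) (tail m)
      shift-guard : ∀ m → (suc B + m * suc B ≤ᵇ suc B + s′) ≡ (m * suc B ≤ᵇ s′)
      shift-guard m = does-⇔ (mk⇔ (ℕ.+-cancelˡ-≤ (suc B) _ _) (ℕ.+-monoʳ-≤ (suc B))) (_ ℕ.≤? _) (_ ℕ.≤? _)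

  byMultiplicity-suc : ∀ B s (g : List ℕ → Carrier) → byMultiplicity (suc B) s g
    ≈ byMultiplicity B s g ⊕ when (suc B ≤ᵇ s) (byMultiplicity (suc B) (s ∸ suc B) (λ μ → g (suc B ∷ μ)))
  byMultiplicity-suc B s g with suc B ℕ.≤? s
  ... | yes 1+B≤s = +-congˡ (≡.subst (λ t → ∑< t (h t) ≈ when (suc B ≤ᵇ t) (byMultiplicity (suc B) (t ∸ suc B) g′))
                                       (ℕ.m+[n∸m]≡n 1+B≤s)
                                       (trans (positive-multiplicity B (s ∸ suc B) g)
                                              (sym (trans (when-≤ᵇ _ (ℕ.m≤m+n (suc B) (s ∸ suc B)))
                                                          (reflexive (≡.cong (λ t → byMultiplicity (suc B) t g′) (ℕ.m+n∸m≡n (suc B) (s ∸ suc B))))))))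
    where
    g′ : List ℕ → Carrier
    g′ μ = g (suc B ∷ μ)
    h : ℕ → ℕ → Carrier
    h t m = when (suc m * suc B ≤ᵇ t) (byMultiplicity B (t ∸ suc m * suc B) (λ μ → g (replicate (suc m) (suc B) ++ μ)))
  ... | no 1+B≰s = +-congˡ (trans (∑<-zero s (λ m _ → when-≰ᵇ (tail m) (ℕ.<-≤-trans (ℕ.≰⇒> 1+B≰s) (ℕ.m≤m+n (suc B) (m * suc B)))))
                                  (sym (when-≰ᵇ (byMultiplicity (suc B) (s ∸ suc B) (λ μ → g (suc B ∷ μ))) (ℕ.≰⇒> 1+B≰s))))
    where
    tail : ℕ → Carrier
    tail m = byMultiplicity B (s ∸ suc m * suc B) (λ μ → g (replicate (suc m) (suc B) ++ μ))

  byFirstPart≈byMultiplicity : ∀ B fuel s (g : List ℕ → Carrier) → s < fuel → byFirstPart fuel B s g ≈ byMultiplicity B s g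
  byFirstPart≈byMultiplicity zero    (suc fuel) s g s<fuel = +-identityʳ _
  byFirstPart≈byMultiplicity (suc B) (suc fuel) s g s<fuel = begin
    byFirstPart (suc fuel) (suc B) s g
      ≈⟨ byFirstPart-suc fuel B s g ⟩
    byFirstPart (suc fuel) B s g ⊕ when (suc B ≤ᵇ s) (byFirstPart fuel (suc B) (s ∸ suc B) (λ μ → g (suc B ∷ μ)))
      ≈⟨ +-cong (byFirstPart≈byMultiplicity B (suc fuel) s g s<fuel)
                (when-cong (suc B ≤ᵇ s) (λ 1+B≤s → byFirstPart≈byMultiplicity (suc B) fuel (s ∸ suc B) (λ μ → g (suc B ∷ μ)) (smaller (≤ᵇ-sound 1+B≤s)))) ⟩
    byMultiplicity B s g ⊕ when (suc B ≤ᵇ s) (byMultiplicity (suc B) (s ∸ suc B) (λ μ → g (suc B ∷ μ)))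
      ≈⟨ sym (byMultiplicity-suc B s g) ⟩
    byMultiplicity (suc B) s g ∎
    where
    smaller : suc B ≤ s → s ∸ suc B < fuel
    smaller 1+B≤s = ℕ.<-≤-trans (ℕ.∸-monoʳ-< {o = 0} (s≤s z≤n) 1+B≤s) (ℕ.≤-pred s<fuel)

  byMultiplicity-cong : ∀ B s {g h : List ℕ → Carrier} → (∀ μ → Grouped B μ → sum μ ≡ s → g μ ≈ h μ) →
                        byMultiplicity B s g ≈ byMultiplicity B s h
  byMultiplicity-cong zero    zero    g≈h = g≈h [] [] ≡.refl
  byMultiplicity-cong zero    (suc s) g≈h = refl
  byMultiplicity-cong (suc B) s       g≈h = ∑<-cong (suc s) (λ m → when-cong (m * suc B ≤ᵇ s) (λ fits →
    byMultiplicity-cong B (s ∸ m * suc B) (λ ν gν Σν≡ → g≈h (replicate m (suc B) ++ ν) (add m gν)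
      (≡.trans (sum-replicate++ m (suc B) ν) (≡.trans (≡.cong (m * suc B +_) Σν≡) (ℕ.m+[n∸m]≡n (≤ᵇ-sound {m * suc B} fits)))))))

  byMultiplicity-*ˡ : ∀ B s a (g : List ℕ → Carrier) → byMultiplicity B s (λ μ → a ⊗ g μ) ≈ a ⊗ byMultiplicity B s g
  byMultiplicity-*ˡ zero    s a g = sym (when-*ˡ (s ≡ᵇ 0) a (g []))
  byMultiplicity-*ˡ (suc B) s a g = trans
    (∑<-cong (suc s) (λ m → trans (when-cong (m * suc B ≤ᵇ s) (λ _ → byMultiplicity-*ˡ B (s ∸ m * suc B) a (λ ν → g (replicate m (suc B) ++ ν))))
                                  (sym (when-*ˡ (m * suc B ≤ᵇ s) a (byMultiplicity B (s ∸ m * suc B) (λ ν → g (replicate m (suc B) ++ ν)))))))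
    (sym (∑<-*ˡ (suc s) a (λ m → when (m * suc B ≤ᵇ s) (byMultiplicity B (s ∸ m * suc B) (λ ν → g (replicate m (suc B) ++ ν))))))

  byMultiplicity-+ : ∀ B s (g h : List ℕ → Carrier) →
                     byMultiplicity B s (λ μ → g μ ⊕ h μ) ≈ byMultiplicity B s g ⊕ byMultiplicity B s h
  byMultiplicity-+ zero    s g h = when-+ (s ≡ᵇ 0) (g []) (h [])
  byMultiplicity-+ (suc B) s g h = trans
    (∑<-cong (suc s) (λ m → trans (when-cong (m * suc B ≤ᵇ s) (λ _ → byMultiplicity-+ B (s ∸ m * suc B) (g′ m) (h′ m)))
                                  (when-+ (m * suc B ≤ᵇ s) (byMultiplicity B (s ∸ m * suc B) (g′ m)) (byMultiplicity B (s ∸ m * suc B) (h′ m)))))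
    (∑<-+ (suc s) (λ m → when (m * suc B ≤ᵇ s) (byMultiplicity B (s ∸ m * suc B) (g′ m)))
                  (λ m → when (m * suc B ≤ᵇ s) (byMultiplicity B (s ∸ m * suc B) (h′ m))))
    where
    g′ h′ : ℕ → List ℕ → Carrier
    g′ m ν = g (replicate m (suc B) ++ ν)
    h′ m ν = h (replicate m (suc B) ++ ν)

module CycleIndex {c ℓ} (R : CommutativeSemiring c ℓ) (f : ℕ → ℕ) (x : CommutativeSemiring.Carrier R) where

  open CommutativeSemiring R renaming (_+_ to _⊕_; _*_ to _⊗_)
  open import Data.Nat using (_≤ᵇ_)
  open import Data.Nat.Induction using (<-rec)
  open import Data.Nat.ListAction using (sum)
  open import Data.List using (replicate; length)
  open import Data.List.Properties using (length-++; length-replicate)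
  open import Defs using (permCount; partitions)
  open import Algebra.Properties.Semiring.Exp semiring using (^-homo-*)
  open import Algebra.Solver.Ring.NaturalCoefficients.Default R using (solve; _:+_; _:*_; _:=_)
  open import Relation.Binary.Reasoning.Setoid setoid
  open Poly R using (ι; rising; _^ᴿ_; oneTo)
  open Sums R
  open Scalars R
  open Rising R
  open Partitions
  open PartitionSums R

  xᵐ : ℕ → Carrier
  xᵐ m = x ^ᴿ m

  -- n!/z_μ for a partition μ of n: the number of permutations of cycle type μ
  permsOfType : List ℕ → ℕ
  permsOfType μ = permCount (sum μ) μ

  -- x^{l(μ) - 1} Σᵢ f(μᵢ), computed by recursion on μ
  marked : List ℕ → Carrier
  marked []      = 0#
  marked (a ∷ μ) = ι (f a) ⊗ xᵐ (length μ) ⊕ x ⊗ marked μ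

  -- permutations of s points all of whose cycles have length at most B, weighted by x^{number of cycles} …
  E : ℕ → ℕ → Carrier
  E B s = byMultiplicity B s (λ μ → ι (permsOfType μ) ⊗ xᵐ (length μ))

  -- … and with one marked cycle, of length k, weighted by f k instead of x
  D : ℕ → ℕ → Carrier
  D B s = byMultiplicity B s (λ μ → ι (permsOfType μ) ⊗ marked μ)

  -- the ways to choose m cycles of length B + 1 among s points
  cycleChoices : ℕ → ℕ → ℕ → Carrier
  cycleChoices B s m = ι ((s C (m * suc B)) * q B m)

  cycleChoices-vanish : ∀ B s m → s < m * suc B → cycleChoices B s m ≈ 0#
  cycleChoices-vanish B s m s<a = ι-cong (≡.cong (_* q B m) (k>n⇒nCk≡0 s<a))

  marked-replicate++ : ∀ m b ν → marked (replicate m b ++ ν)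
                       ≈ ι (m * f b) ⊗ xᵐ (m ∸ 1) ⊗ xᵐ (length ν) ⊕ xᵐ m ⊗ marked ν
  marked-replicate++ zero          b ν = sym (trans (+-congʳ (trans (*-congʳ (zeroˡ _)) (zeroˡ _))) (trans (+-identityˡ _) (*-identityˡ _)))
  marked-replicate++ (suc zero)    b ν = +-cong (*-congʳ (trans (ι-cong (≡.sym (ℕ.+-identityʳ (f b)))) (sym (*-identityʳ _))))
                                               (*-congʳ (sym (*-identityʳ x)))
  marked-replicate++ (suc (suc m)) b ν = begin
    ι (f b) ⊗ xᵐ (length (replicate (suc m) b ++ ν)) ⊕ x ⊗ marked (replicate (suc m) b ++ ν)
      ≈⟨ +-cong (*-congˡ (trans (reflexive (≡.cong xᵐ (len-eq (suc m)))) (^-homo-* x (suc m) (length ν))))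
                (*-congˡ (marked-replicate++ (suc m) b ν)) ⟩
    ι (f b) ⊗ (xᵐ (suc m) ⊗ xᵐ (length ν)) ⊕ x ⊗ (ι (suc m * f b) ⊗ xᵐ m ⊗ xᵐ (length ν) ⊕ xᵐ (suc m) ⊗ marked ν)
      ≈⟨ +-congˡ (*-congˡ (+-congʳ (*-congʳ (*-congʳ (ι-* (suc m) (f b)))))) ⟩
    ι (f b) ⊗ (xᵐ (suc m) ⊗ xᵐ (length ν)) ⊕ x ⊗ (ι (suc m) ⊗ ι (f b) ⊗ xᵐ m ⊗ xᵐ (length ν) ⊕ xᵐ (suc m) ⊗ marked ν)
      ≈⟨ solve 6 (λ F X Y Z M K → F :* (X :* Y :* Z) :+ X :* (M :* F :* Y :* Z :+ X :* Y :* K)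
                                   := (F :+ M :* F) :* (X :* Y) :* Z :+ X :* (X :* Y) :* K)
               refl (ι (f b)) x (xᵐ m) (xᵐ (length ν)) (ι (suc m)) (marked ν) ⟩
    (ι (f b) ⊕ ι (suc m) ⊗ ι (f b)) ⊗ xᵐ (suc m) ⊗ xᵐ (length ν) ⊕ xᵐ (suc (suc m)) ⊗ marked ν
      ≈⟨ +-congʳ (*-congʳ (*-congʳ (sym (trans (ι-+ (f b) (suc m * f b)) (+-congˡ (ι-* (suc m) (f b))))))) ⟩
    ι (suc (suc m) * f b) ⊗ xᵐ (suc m) ⊗ xᵐ (length ν) ⊕ xᵐ (suc (suc m)) ⊗ marked ν ∎
    where
    len-eq : ∀ k → length (replicate k b ++ ν) ≡ k + length ν
    len-eq k = ≡.trans (length-++ (replicate k b)) (≡.cong (_+ length ν) (length-replicate k))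

  marked≈ : ∀ μ → xᵐ (length μ ∸ 1) ⊗ ι (sum (map f μ)) ≈ marked μ
  marked≈ []      = zeroʳ _
  marked≈ (a ∷ μ) = trans (*-congˡ (ι-+ (f a) (sum (map f μ)))) (trans (distribˡ _ _ _) (+-cong (*-comm _ _) (rest μ)))
    where
    rest : ∀ ν → xᵐ (length ν) ⊗ ι (sum (map f ν)) ≈ x ⊗ marked ν
    rest []      = trans (zeroʳ _) (sym (zeroʳ x))
    rest (b ∷ ν) = trans (*-assoc x _ _) (*-congˡ (marked≈ (b ∷ ν)))

  permsOfType-replicate++ : ∀ {B ν} s m → Grouped B ν → sum ν ≡ s ∸ m * suc B → m * suc B ≤ s →
                   permsOfType (replicate m (suc B) ++ ν) ≡ (s C (m * suc B)) * q B m * permsOfType ν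
  permsOfType-replicate++ {B} {ν} s m g Σν≡ a≤s = ≡.trans (permCount-replicate++ m g)
    (≡.cong (λ t → (t C (m * suc B)) * q B m * permsOfType ν) (≡.trans (≡.cong (m * suc B +_) Σν≡) (ℕ.m+[n∸m]≡n a≤s)))

  byMultiplicity-expand : ∀ B s (h : List ℕ → Carrier) (T : ℕ → Carrier) →
    (∀ m → m * suc B ≤ s → byMultiplicity B (s ∸ m * suc B) (λ ν → ι (permsOfType (replicate m (suc B) ++ ν)) ⊗ h (replicate m (suc B) ++ ν))
                            ≈ cycleChoices B s m ⊗ T m) →
    byMultiplicity (suc B) s (λ μ → ι (permsOfType μ) ⊗ h μ) ≈ ∑< (suc s) (λ m → cycleChoices B s m ⊗ T m)
  byMultiplicity-expand B s h T expand = ∑<-cong (suc s) term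
    where
    term : ∀ m → when (m * suc B ≤ᵇ s) (byMultiplicity B (s ∸ m * suc B) (λ ν → ι (permsOfType (replicate m (suc B) ++ ν)) ⊗ h (replicate m (suc B) ++ ν)))
                 ≈ cycleChoices B s m ⊗ T m
    term m with m * suc B ℕ.≤? s
    ... | yes a≤s = trans (when-≤ᵇ _ a≤s) (expand m a≤s)
    ... | no  a≰s = trans (when-≰ᵇ _ (ℕ.≰⇒> a≰s)) (sym (trans (*-congʳ (cycleChoices-vanish B s m (ℕ.≰⇒> a≰s))) (zeroˡ _)))

  private
    ι-permsOfType : ∀ {B ν} s m → Grouped B ν → sum ν ≡ s ∸ m * suc B → m * suc B ≤ s →
           ι (permsOfType (replicate m (suc B) ++ ν)) ≈ cycleChoices B s m ⊗ ι (permsOfType ν)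
    ι-permsOfType {B} {ν} s m g Σν≡ a≤s = trans (ι-cong (permsOfType-replicate++ s m g Σν≡ a≤s)) (ι-* ((s C (m * suc B)) * q B m) (permsOfType ν))

    xᵐ-length : ∀ m (b : ℕ) ν → xᵐ (length (replicate m b ++ ν)) ≈ xᵐ m ⊗ xᵐ (length ν)
    xᵐ-length m b ν = trans (reflexive (≡.cong xᵐ (≡.trans (length-++ (replicate m b)) (≡.cong (_+ length ν) (length-replicate m)))))
                            (^-homo-* x m (length ν))

  E-step : ∀ B s → E (suc B) s ≈ ∑< (suc s) (λ m → cycleChoices B s m ⊗ (xᵐ m ⊗ E B (s ∸ m * suc B)))
  E-step B s = byMultiplicity-expand B s (xᵐ ∘ length) (λ m → xᵐ m ⊗ E B (s ∸ m * suc B)) (λ m a≤s → begin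
    byMultiplicity B (s ∸ m * suc B) (λ ν → ι (permsOfType (replicate m (suc B) ++ ν)) ⊗ xᵐ (length (replicate m (suc B) ++ ν)))
      ≈⟨ byMultiplicity-cong B (s ∸ m * suc B) (λ ν g Σν≡ → trans (*-cong (ι-permsOfType s m g Σν≡ a≤s) (xᵐ-length m (suc B) ν))
                                                                   (regroup (cycleChoices B s m) (ι (permsOfType ν)) (xᵐ m) (xᵐ (length ν)))) ⟩
    byMultiplicity B (s ∸ m * suc B) (λ ν → (cycleChoices B s m ⊗ xᵐ m) ⊗ (ι (permsOfType ν) ⊗ xᵐ (length ν)))
      ≈⟨ byMultiplicity-*ˡ B (s ∸ m * suc B) (cycleChoices B s m ⊗ xᵐ m) (λ ν → ι (permsOfType ν) ⊗ xᵐ (length ν)) ⟩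
    (cycleChoices B s m ⊗ xᵐ m) ⊗ E B (s ∸ m * suc B)
      ≈⟨ *-assoc _ _ _ ⟩
    cycleChoices B s m ⊗ (xᵐ m ⊗ E B (s ∸ m * suc B)) ∎)
    where
    regroup : ∀ a b c d → a ⊗ b ⊗ (c ⊗ d) ≈ (a ⊗ c) ⊗ (b ⊗ d)
    regroup = solve 4 (λ a b c d → a :* b :* (c :* d) := (a :* c) :* (b :* d)) refl

  D-step : ∀ B s → D (suc B) s ≈ ∑< (suc s) (λ m → cycleChoices B s m ⊗
                     (ι (m * f (suc B)) ⊗ xᵐ (m ∸ 1) ⊗ E B (s ∸ m * suc B) ⊕ xᵐ m ⊗ D B (s ∸ m * suc B)))
  D-step B s = byMultiplicity-expand B s marked
    (λ m → marking m ⊗ E B (s ∸ m * suc B) ⊕ xᵐ m ⊗ D B (s ∸ m * suc B)) (λ m a≤s → begin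
    byMultiplicity B (s ∸ m * suc B) (λ ν → ι (permsOfType (replicate m (suc B) ++ ν)) ⊗ marked (replicate m (suc B) ++ ν))
      ≈⟨ byMultiplicity-cong B (s ∸ m * suc B) (λ ν g Σν≡ → trans (*-cong (ι-permsOfType s m g Σν≡ a≤s) (marked-replicate++ m (suc B) ν))
                                                                   (regroup (cycleChoices B s m) (ι (permsOfType ν)) (marking m) (xᵐ (length ν)) (xᵐ m) (marked ν))) ⟩
    byMultiplicity B (s ∸ m * suc B) (λ ν → (cycleChoices B s m ⊗ marking m) ⊗ (ι (permsOfType ν) ⊗ xᵐ (length ν)) ⊕ (cycleChoices B s m ⊗ xᵐ m) ⊗ (ι (permsOfType ν) ⊗ marked ν))
      ≈⟨ byMultiplicity-+ B (s ∸ m * suc B) _ _ ⟩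
    byMultiplicity B (s ∸ m * suc B) (λ ν → (cycleChoices B s m ⊗ marking m) ⊗ (ι (permsOfType ν) ⊗ xᵐ (length ν)))
      ⊕ byMultiplicity B (s ∸ m * suc B) (λ ν → (cycleChoices B s m ⊗ xᵐ m) ⊗ (ι (permsOfType ν) ⊗ marked ν))
      ≈⟨ +-cong (byMultiplicity-*ˡ B (s ∸ m * suc B) _ (λ ν → ι (permsOfType ν) ⊗ xᵐ (length ν)))
                (byMultiplicity-*ˡ B (s ∸ m * suc B) _ (λ ν → ι (permsOfType ν) ⊗ marked ν)) ⟩
    (cycleChoices B s m ⊗ marking m) ⊗ E B (s ∸ m * suc B) ⊕ (cycleChoices B s m ⊗ xᵐ m) ⊗ D B (s ∸ m * suc B)
      ≈⟨ solve 5 (λ a c e p d → (a :* c) :* e :+ (a :* p) :* d := a :* (c :* e :+ p :* d)) refl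
               (cycleChoices B s m) (marking m) (E B (s ∸ m * suc B)) (xᵐ m) (D B (s ∸ m * suc B)) ⟩
    cycleChoices B s m ⊗ (marking m ⊗ E B (s ∸ m * suc B) ⊕ xᵐ m ⊗ D B (s ∸ m * suc B)) ∎)
    where
    marking : ℕ → Carrier
    marking m = ι (m * f (suc B)) ⊗ xᵐ (m ∸ 1)
    regroup : ∀ a b c l p d → a ⊗ b ⊗ (c ⊗ l ⊕ p ⊗ d) ≈ (a ⊗ c) ⊗ (b ⊗ l) ⊕ (a ⊗ p) ⊗ (b ⊗ d)
    regroup = solve 6 (λ a b c l p d → a :* b :* (c :* l :+ p :* d) := (a :* c) :* (b :* l) :+ (a :* p) :* (b :* d)) refl

  E-step-wide : ∀ B t L → suc t ≤ L → ∑< L (λ m → cycleChoices B t m ⊗ (xᵐ m ⊗ E B (t ∸ m * suc B))) ≈ E (suc B) t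
  E-step-wide B t L 1+t≤L = trans
    (∑<-truncate (λ m → cycleChoices B t m ⊗ (xᵐ m ⊗ E B (t ∸ m * suc B))) 1+t≤L
                 (λ m 1+t≤m → trans (*-congʳ (cycleChoices-vanish B t m (ℕ.<-≤-trans 1+t≤m (ℕ.m≤m*n m (suc B))))) (zeroˡ _)))
    (sym (E-step B t))

  -- first choosing the (B+1)-cycles and then j of the remaining points, or the other way round
  cycles-then-choose : ∀ B s j κ →
    ∑< (suc s) (λ m → cycleChoices B s m ⊗ (xᵐ m ⊗ (ι ((s ∸ m * suc B) C j) ⊗ (κ ⊗ E B (s ∸ m * suc B ∸ j)))))
    ≈ ι (s C j) ⊗ (κ ⊗ E (suc B) (s ∸ j))
  cycles-then-choose B s j κ = begin
    ∑< (suc s) (λ m → cycleChoices B s m ⊗ (xᵐ m ⊗ (ι ((s ∸ m * suc B) C j) ⊗ (κ ⊗ E B (s ∸ m * suc B ∸ j)))))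
      ≈⟨ ∑<-cong (suc s) swap ⟩
    ∑< (suc s) (λ m → (ι (s C j) ⊗ κ) ⊗ (cycleChoices B (s ∸ j) m ⊗ (xᵐ m ⊗ E B (s ∸ j ∸ m * suc B))))
      ≈⟨ sym (∑<-*ˡ (suc s) (ι (s C j) ⊗ κ) (λ m → cycleChoices B (s ∸ j) m ⊗ (xᵐ m ⊗ E B (s ∸ j ∸ m * suc B)))) ⟩
    (ι (s C j) ⊗ κ) ⊗ ∑< (suc s) (λ m → cycleChoices B (s ∸ j) m ⊗ (xᵐ m ⊗ E B (s ∸ j ∸ m * suc B)))
      ≈⟨ *-congˡ (E-step-wide B (s ∸ j) (suc s) (s≤s (ℕ.m∸n≤m s j))) ⟩
    (ι (s C j) ⊗ κ) ⊗ E (suc B) (s ∸ j)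
      ≈⟨ *-assoc _ _ _ ⟩
    ι (s C j) ⊗ (κ ⊗ E (suc B) (s ∸ j)) ∎
    where
    swap : ∀ m → cycleChoices B s m ⊗ (xᵐ m ⊗ (ι ((s ∸ m * suc B) C j) ⊗ (κ ⊗ E B (s ∸ m * suc B ∸ j))))
                 ≈ (ι (s C j) ⊗ κ) ⊗ (cycleChoices B (s ∸ j) m ⊗ (xᵐ m ⊗ E B (s ∸ j ∸ m * suc B)))
    swap m = begin
      ι (Cₐ * q B m) ⊗ (xᵐ m ⊗ (ι ((s ∸ a) C j) ⊗ (κ ⊗ E B (s ∸ a ∸ j))))
        ≈⟨ solve 5 (λ c X d k e → c :* (X :* (d :* (k :* e))) := c :* d :* (k :* (X :* e))) refl
                 (ι (Cₐ * q B m)) (xᵐ m) (ι ((s ∸ a) C j)) κ (E B (s ∸ a ∸ j)) ⟩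
      ι (Cₐ * q B m) ⊗ ι ((s ∸ a) C j) ⊗ (κ ⊗ (xᵐ m ⊗ E B (s ∸ a ∸ j)))
        ≈⟨ *-cong (trans (sym (ι-* (Cₐ * q B m) ((s ∸ a) C j))) (trans (ι-cong coefficients) (ι-* (s C j) (((s ∸ j) C a) * q B m))))
                  (*-congˡ (*-congˡ (reflexive (≡.cong (E B) ∸-swap)))) ⟩
      ι (s C j) ⊗ cycleChoices B (s ∸ j) m ⊗ (κ ⊗ (xᵐ m ⊗ E B (s ∸ j ∸ a)))
        ≈⟨ solve 4 (λ c d k r → c :* d :* (k :* r) := (c :* k) :* (d :* r)) refl
                 (ι (s C j)) (cycleChoices B (s ∸ j) m) κ (xᵐ m ⊗ E B (s ∸ j ∸ a)) ⟩
      (ι (s C j) ⊗ κ) ⊗ (cycleChoices B (s ∸ j) m ⊗ (xᵐ m ⊗ E B (s ∸ j ∸ a))) ∎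
      where
      a Cₐ : ℕ
      a = m * suc B
      Cₐ = s C a
      coefficients : Cₐ * q B m * ((s ∸ a) C j) ≡ (s C j) * (((s ∸ j) C a) * q B m)
      coefficients = ≡.trans (ℕ.*-assoc Cₐ (q B m) _) (≡.trans (≡.cong (Cₐ *_) (ℕ.*-comm (q B m) _))
                     (≡.trans (≡.sym (ℕ.*-assoc Cₐ _ (q B m))) (≡.trans (≡.cong (_* q B m) (C-trinomial-swap s a j))
                     (ℕ.*-assoc (s C j) _ (q B m)))))
      ∸-swap : s ∸ a ∸ j ≡ s ∸ j ∸ a
      ∸-swap = ≡.trans (ℕ.∸-+-assoc s a j) (≡.trans (≡.cong (s ∸_) (ℕ.+-comm a j)) (≡.sym (ℕ.∸-+-assoc s j a)))

  through-cycles : ∀ B s (J : ℕ → ℕ) (φ : ℕ → Carrier) →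
    ∑< (suc s) (λ m → cycleChoices B s m ⊗ (xᵐ m ⊗ ∑< B (λ k → ι ((s ∸ m * suc B) C J k) ⊗ (φ k ⊗ E B (s ∸ m * suc B ∸ J k)))))
    ≈ ∑< B (λ k → ι (s C J k) ⊗ (φ k ⊗ E (suc B) (s ∸ J k)))
  through-cycles B s J φ = begin
    ∑< (suc s) (λ m → cycleChoices B s m ⊗ (xᵐ m ⊗ ∑< B (T m)))
      ≈⟨ ∑<-cong (suc s) (λ m → trans (*-congˡ (∑<-*ˡ B (xᵐ m) (T m))) (∑<-*ˡ B (cycleChoices B s m) (λ k → xᵐ m ⊗ T m k))) ⟩
    ∑< (suc s) (λ m → ∑< B (λ k → cycleChoices B s m ⊗ (xᵐ m ⊗ T m k)))
      ≈⟨ ∑<-comm (suc s) B (λ m k → cycleChoices B s m ⊗ (xᵐ m ⊗ T m k)) ⟩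
    ∑< B (λ k → ∑< (suc s) (λ m → cycleChoices B s m ⊗ (xᵐ m ⊗ T m k)))
      ≈⟨ ∑<-cong B (λ k → cycles-then-choose B s (J k) (φ k)) ⟩
    ∑< B (λ k → ι (s C J k) ⊗ (φ k ⊗ E (suc B) (s ∸ J k))) ∎
    where
    T : ℕ → ℕ → Carrier
    T m k = ι ((s ∸ m * suc B) C J k) ⊗ (φ k ⊗ E B (s ∸ m * suc B ∸ J k))

  -- a distinguished set of c points, then cycles of length B + 1 and shorter ones on the rest
  cycle-through : ∀ B s c L κ → suc (s ∸ c) ≤ L →
    ∑< L (λ m → ι ((s C c) * (((s ∸ c) C (m * suc B)) * q B m)) ⊗ κ ⊗ (xᵐ m ⊗ E B (s ∸ (c + m * suc B))))
    ≈ ι (s C c) ⊗ (κ ⊗ E (suc B) (s ∸ c))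
  cycle-through B s c L κ 1+s∸c≤L = begin
    ∑< L (λ m → ι ((s C c) * (((s ∸ c) C (m * suc B)) * q B m)) ⊗ κ ⊗ (xᵐ m ⊗ E B (s ∸ (c + m * suc B))))
      ≈⟨ ∑<-cong L (λ m → trans (*-congʳ (*-congʳ (ι-* (s C c) (((s ∸ c) C (m * suc B)) * q B m))))
                               (trans (regroup (ι (s C c)) (cycleChoices B (s ∸ c) m) κ (xᵐ m) _)
                                      (*-congˡ (*-congˡ (*-congˡ (reflexive (≡.cong (E B) (≡.sym (ℕ.∸-+-assoc s c (m * suc B)))))))))) ⟩
    ∑< L (λ m → (ι (s C c) ⊗ κ) ⊗ (cycleChoices B (s ∸ c) m ⊗ (xᵐ m ⊗ E B (s ∸ c ∸ m * suc B))))
      ≈⟨ sym (∑<-*ˡ L (ι (s C c) ⊗ κ) (λ m → cycleChoices B (s ∸ c) m ⊗ (xᵐ m ⊗ E B (s ∸ c ∸ m * suc B)))) ⟩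
    (ι (s C c) ⊗ κ) ⊗ ∑< L (λ m → cycleChoices B (s ∸ c) m ⊗ (xᵐ m ⊗ E B (s ∸ c ∸ m * suc B)))
      ≈⟨ trans (*-congˡ (E-step-wide B (s ∸ c) L 1+s∸c≤L)) (*-assoc _ _ _) ⟩
    ι (s C c) ⊗ (κ ⊗ E (suc B) (s ∸ c)) ∎
    where
    regroup : ∀ a b k X e → a ⊗ b ⊗ k ⊗ (X ⊗ e) ≈ (a ⊗ k) ⊗ (b ⊗ (X ⊗ e))
    regroup = solve 5 (λ a b k X e → a :* b :* k :* (X :* e) := (a :* k) :* (b :* (X :* e))) refl

  cycleChoices-pascal : ∀ B s m → cycleChoices B (suc s) (suc m)
                        ≈ cycleChoices B s (suc m) ⊕ ι ((s C B) * (((s ∸ B) C (m * suc B)) * q B m)) ⊗ ι (B !)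
  cycleChoices-pascal B s m = begin
    ι ((suc s C suc a′) * q B (suc m))
      ≈⟨ trans (ι-cong (≡.trans (≡.cong (_* q B (suc m)) (C-pascal s a′)) (ℕ.*-distribʳ-+ (q B (suc m)) (s C a′) _)))
               (ι-+ ((s C a′) * q B (suc m)) _) ⟩
    ι ((s C a′) * q B (suc m)) ⊕ cycleChoices B s (suc m)
      ≈⟨ trans (+-comm _ _) (+-congˡ (trans (ι-cong (q-through s B m)) (ι-* ((s C B) * (((s ∸ B) C (m * suc B)) * q B m)) (B !)))) ⟩
    cycleChoices B s (suc m) ⊕ ι ((s C B) * (((s ∸ B) C (m * suc B)) * q B m)) ⊗ ι (B !) ∎
    where
    a′ : ℕ
    a′ = B + m * suc B

  -- a given point lies on one of the cycles of length B + 1 …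
  E-step-through : ∀ B s →
    ∑< (suc s) (λ m → ι ((s C B) * (((s ∸ B) C (m * suc B)) * q B m)) ⊗ ι (B !) ⊗ (x ⊗ xᵐ m ⊗ E B (s ∸ (B + m * suc B))))
    ≈ ι (s C B) ⊗ (ι (B !) ⊗ x ⊗ E (suc B) (s ∸ B))
  E-step-through B s = trans
    (∑<-cong (suc s) (λ m → solve 5 (λ K F X Y e → K :* F :* (X :* Y :* e) := K :* (F :* X) :* (Y :* e)) refl
                                    (ι ((s C B) * (((s ∸ B) C (m * suc B)) * q B m))) (ι (B !)) x (xᵐ m) (E B (s ∸ (B + m * suc B)))))
    (cycle-through B s B (suc s) (ι (B !) ⊗ x) (s≤s (ℕ.m∸n≤m s B)))

  -- … or it does not, and then it lies on a shorter cycle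
  E-step-avoiding : ∀ B s → (∀ t → E B (suc t) ≈ ∑< B (λ k → ι (t C k) ⊗ (ι (k !) ⊗ x ⊗ E B (t ∸ k)))) →
    ∑< (suc (suc s)) (λ m → cycleChoices B s m ⊗ (xᵐ m ⊗ E B (suc s ∸ m * suc B)))
    ≈ ∑< B (λ k → ι (s C k) ⊗ (ι (k !) ⊗ x ⊗ E (suc B) (s ∸ k)))
  E-step-avoiding B s E-recB = begin
    ∑< (suc (suc s)) T
      ≈⟨ ∑<-truncate T (ℕ.n≤1+n (suc s))
           (λ m 1+s≤m → trans (*-congʳ (cycleChoices-vanish B s m (ℕ.<-≤-trans 1+s≤m (ℕ.m≤m*n m (suc B))))) (zeroˡ _)) ⟩
    ∑< (suc s) T
      ≈⟨ ∑<-cong (suc s) recurse ⟩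
    ∑< (suc s) (λ m → cycleChoices B s m ⊗ (xᵐ m ⊗ ∑< B (λ k → ι ((s ∸ m * suc B) C k) ⊗ (ι (k !) ⊗ x ⊗ E B (s ∸ m * suc B ∸ k)))))
      ≈⟨ through-cycles B s (λ k → k) (λ k → ι (k !) ⊗ x) ⟩
    ∑< B (λ k → ι (s C k) ⊗ (ι (k !) ⊗ x ⊗ E (suc B) (s ∸ k))) ∎
    where
    T : ℕ → Carrier
    T m = cycleChoices B s m ⊗ (xᵐ m ⊗ E B (suc s ∸ m * suc B))
    recurse : ∀ m → T m ≈ cycleChoices B s m ⊗ (xᵐ m ⊗ ∑< B (λ k → ι ((s ∸ m * suc B) C k) ⊗ (ι (k !) ⊗ x ⊗ E B (s ∸ m * suc B ∸ k))))
    recurse m with m * suc B ℕ.≤? s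
    ... | yes a≤s = *-congˡ (*-congˡ (trans (reflexive (≡.cong (E B) (ℕ.+-∸-assoc 1 a≤s))) (E-recB (s ∸ m * suc B))))
    ... | no  a≰s = trans (*-congʳ vanish) (trans (zeroˡ _) (sym (trans (*-congʳ vanish) (zeroˡ _))))
      where
      vanish : cycleChoices B s m ≈ 0#
      vanish = cycleChoices-vanish B s m (ℕ.≰⇒> a≰s)

  -- the cycle through a given point, of length k + 1 ≤ B
  E-rec : ∀ B s → E B (suc s) ≈ ∑< B (λ k → ι (s C k) ⊗ (ι (k !) ⊗ x ⊗ E B (s ∸ k)))
  E-rec zero    s = refl
  E-rec (suc B) s = begin
    E (suc B) (suc s)
      ≈⟨ E-step B (suc s) ⟩
    cycleChoices B (suc s) 0 ⊗ T 0 ⊕ ∑< (suc s) (λ m → cycleChoices B (suc s) (suc m) ⊗ T (suc m))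
      ≈⟨ +-congˡ (trans (∑<-cong (suc s) (λ m → trans (*-congʳ (cycleChoices-pascal B s m)) (distribʳ (T (suc m)) _ _)))
                        (∑<-+ (suc s) (λ m → cycleChoices B s (suc m) ⊗ T (suc m)) through)) ⟩
    cycleChoices B s 0 ⊗ T 0 ⊕ (∑< (suc s) (λ m → cycleChoices B s (suc m) ⊗ T (suc m)) ⊕ ∑< (suc s) through)
      ≈⟨ sym (+-assoc _ _ _) ⟩
    ∑< (suc (suc s)) (λ m → cycleChoices B s m ⊗ T m) ⊕ ∑< (suc s) through
      ≈⟨ +-cong (E-step-avoiding B s (E-rec B)) (E-step-through B s) ⟩
    ∑< B (λ k → ι (s C k) ⊗ (ι (k !) ⊗ x ⊗ E (suc B) (s ∸ k))) ⊕ ι (s C B) ⊗ (ι (B !) ⊗ x ⊗ E (suc B) (s ∸ B))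
      ≈⟨ sym (∑<-last B (λ k → ι (s C k) ⊗ (ι (k !) ⊗ x ⊗ E (suc B) (s ∸ k)))) ⟩
    ∑< (suc B) (λ k → ι (s C k) ⊗ (ι (k !) ⊗ x ⊗ E (suc B) (s ∸ k))) ∎
    where
    T : ℕ → Carrier
    T m = xᵐ m ⊗ E B (suc s ∸ m * suc B)
    through : ℕ → Carrier
    through m = ι ((s C B) * (((s ∸ B) C (m * suc B)) * q B m)) ⊗ ι (B !) ⊗ T (suc m)

  E-zero : ∀ B → E B 0 ≈ 1#
  E-zero zero    = trans (*-identityʳ _) ι-1
  E-zero (suc B) = trans (+-identityʳ _) (E-zero B)

  E-value : ∀ B s → s ≤ B → E B s ≈ rising x s
  E-value B = <-rec (λ s → s ≤ B → E B s ≈ rising x s) step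
    where
    step : ∀ s → (∀ {t} → t < s → t ≤ B → E B t ≈ rising x t) → s ≤ B → E B s ≈ rising x s
    step zero    _   _     = E-zero B
    step (suc s) rec 1+s≤B = begin
      E B (suc s)
        ≈⟨ E-rec B s ⟩
      ∑< B (λ k → ι (s C k) ⊗ (ι (k !) ⊗ x ⊗ E B (s ∸ k)))
        ≈⟨ ∑<-truncate (λ k → ι (s C k) ⊗ (ι (k !) ⊗ x ⊗ E B (s ∸ k))) 1+s≤B
             (λ k 1+s≤k → trans (*-congʳ (ι-cong (k>n⇒nCk≡0 1+s≤k))) (zeroˡ _)) ⟩
      ∑< (suc s) (λ k → ι (s C k) ⊗ (ι (k !) ⊗ x ⊗ E B (s ∸ k)))
        ≈⟨ ∑<-congᵇ (suc s) term ⟩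
      ∑< (suc s) (λ k → x ⊗ (ι (s C k) ⊗ (rising 1# k ⊗ rising x (s ∸ k))))
        ≈⟨ sym (∑<-*ˡ (suc s) x (λ k → ι (s C k) ⊗ (rising 1# k ⊗ rising x (s ∸ k)))) ⟩
      x ⊗ ∑< (suc s) (λ k → ι (s C k) ⊗ (rising 1# k ⊗ rising x (s ∸ k)))
        ≈⟨ *-congˡ (sym (rising-vandermonde 1# x s)) ⟩
      x ⊗ rising (1# ⊕ x) s
        ≈⟨ sym (rising-sucˡ x s) ⟩
      rising x (suc s) ∎
      where
      term : ∀ k → k < suc s → ι (s C k) ⊗ (ι (k !) ⊗ x ⊗ E B (s ∸ k)) ≈ x ⊗ (ι (s C k) ⊗ (rising 1# k ⊗ rising x (s ∸ k)))
      term k _ = trans (*-congˡ (*-cong (*-congʳ (sym (rising-one k)))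
                                        (rec (s≤s (ℕ.m∸n≤m s k)) (ℕ.≤-trans (ℕ.m∸n≤m s k) (ℕ.<⇒≤ 1+s≤B)))))
                       (solve 4 (λ c r x e → c :* (r :* x :* e) := x :* (c :* (r :* e))) refl (ι (s C k)) (rising 1# k) x (rising x (s ∸ k)))

  -- the marked cycle is one of the cycles of length B + 1 …
  D-step-marked : ∀ B s → ∑< (suc s) (λ m → cycleChoices B s m ⊗ (ι (m * f (suc B)) ⊗ xᵐ (m ∸ 1) ⊗ E B (s ∸ m * suc B)))
                          ≈ ι (s C suc B) ⊗ (ι (f (suc B) * B !) ⊗ E (suc B) (s ∸ suc B))
  D-step-marked B s = begin
    T 0 ⊕ ∑< s (λ m → T (suc m))
      ≈⟨ trans (+-congʳ (trans (*-congˡ (trans (*-congʳ (zeroˡ 1#)) (zeroˡ (E B s)))) (zeroʳ (cycleChoices B s 0)))) (+-identityˡ _) ⟩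
    ∑< s (λ m → T (suc m))
      ≈⟨ sym (∑<-truncate (λ m → T (suc m)) (ℕ.n≤1+n s)
               (λ m s≤m → trans (*-congʳ (cycleChoices-vanish B s (suc m) (ℕ.<-≤-trans (s≤s s≤m) (ℕ.m≤m*n (suc m) (suc B))))) (zeroˡ _))) ⟩
    ∑< (suc s) (λ m → T (suc m))
      ≈⟨ ∑<-cong (suc s) regroup ⟩
    ∑< (suc s) (λ m → ι ((s C suc B) * (((s ∸ suc B) C (m * suc B)) * q B m)) ⊗ ι (w * B !) ⊗ (xᵐ m ⊗ E B (s ∸ (suc B + m * suc B))))
      ≈⟨ cycle-through B s (suc B) (suc s) (ι (w * B !)) (s≤s (ℕ.m∸n≤m s (suc B))) ⟩
    ι (s C suc B) ⊗ (ι (w * B !) ⊗ E (suc B) (s ∸ suc B)) ∎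
    where
    w : ℕ
    w = f (suc B)
    T : ℕ → Carrier
    T m = cycleChoices B s m ⊗ (ι (m * w) ⊗ xᵐ (m ∸ 1) ⊗ E B (s ∸ m * suc B))
    regroup : ∀ m → T (suc m) ≈ ι ((s C suc B) * (((s ∸ suc B) C (m * suc B)) * q B m)) ⊗ ι (w * B !) ⊗ (xᵐ m ⊗ E B (s ∸ (suc B + m * suc B)))
    regroup m = begin
      ι ((s C (suc m * suc B)) * q B (suc m)) ⊗ (ι (suc m * w) ⊗ xᵐ m ⊗ E B (s ∸ suc m * suc B))
        ≈⟨ solve 4 (λ c k X e → c :* (k :* X :* e) := c :* k :* (X :* e)) refl
                 (ι ((s C (suc m * suc B)) * q B (suc m))) (ι (suc m * w)) (xᵐ m) (E B (s ∸ suc m * suc B)) ⟩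
      ι ((s C (suc m * suc B)) * q B (suc m)) ⊗ ι (suc m * w) ⊗ (xᵐ m ⊗ E B (s ∸ suc m * suc B))
        ≈⟨ *-congʳ (trans (sym (ι-* ((s C (suc m * suc B)) * q B (suc m)) (suc m * w)))
                          (trans (ι-cong (q-marked s B m w)) (ι-* ((s C suc B) * (((s ∸ suc B) C (m * suc B)) * q B m)) (w * B !)))) ⟩
      ι ((s C suc B) * (((s ∸ suc B) C (m * suc B)) * q B m)) ⊗ ι (w * B !) ⊗ (xᵐ m ⊗ E B (s ∸ (suc B + m * suc B))) ∎

  -- … or it is shorter, of length k + 1 ≤ B, and the other cycles are counted by E
  D-form : ∀ B s → D B s ≈ ∑< B (λ k → ι (s C suc k) ⊗ (ι (f (suc k) * k !) ⊗ E B (s ∸ suc k)))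
  D-form zero    zero    = zeroʳ _
  D-form zero    (suc s) = refl
  D-form (suc B) s = begin
    D (suc B) s
      ≈⟨ D-step B s ⟩
    ∑< (suc s) (λ m → cycleChoices B s m ⊗ (marking m ⊗ E B (s ∸ m * suc B) ⊕ xᵐ m ⊗ D B (s ∸ m * suc B)))
      ≈⟨ trans (∑<-cong (suc s) (λ m → distribˡ (cycleChoices B s m) (marking m ⊗ E B (s ∸ m * suc B)) (xᵐ m ⊗ D B (s ∸ m * suc B))))
               (∑<-+ (suc s) (λ m → cycleChoices B s m ⊗ (marking m ⊗ E B (s ∸ m * suc B))) unmarked) ⟩
    ∑< (suc s) (λ m → cycleChoices B s m ⊗ (marking m ⊗ E B (s ∸ m * suc B))) ⊕ ∑< (suc s) unmarked
      ≈⟨ +-cong (D-step-marked B s) unmarked-part ⟩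
    ι (s C suc B) ⊗ G B ⊕ ∑< B (λ k → ι (s C suc k) ⊗ G k)
      ≈⟨ trans (+-comm _ _) (sym (∑<-last B (λ k → ι (s C suc k) ⊗ G k))) ⟩
    ∑< (suc B) (λ k → ι (s C suc k) ⊗ G k) ∎
    where
    marking : ℕ → Carrier
    marking m = ι (m * f (suc B)) ⊗ xᵐ (m ∸ 1)
    G : ℕ → Carrier
    G k = ι (f (suc k) * k !) ⊗ E (suc B) (s ∸ suc k)
    unmarked : ℕ → Carrier
    unmarked m = cycleChoices B s m ⊗ (xᵐ m ⊗ D B (s ∸ m * suc B))
    unmarked-part : ∑< (suc s) unmarked ≈ ∑< B (λ k → ι (s C suc k) ⊗ G k)
    unmarked-part = begin
      ∑< (suc s) unmarked
        ≈⟨ ∑<-cong (suc s) (λ m → *-congˡ {cycleChoices B s m} (*-congˡ {xᵐ m} (D-form B (s ∸ m * suc B)))) ⟩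
      ∑< (suc s) (λ m → cycleChoices B s m ⊗ (xᵐ m ⊗ ∑< B (λ k → ι ((s ∸ m * suc B) C suc k) ⊗ (ι (f (suc k) * k !) ⊗ E B (s ∸ m * suc B ∸ suc k)))))
        ≈⟨ through-cycles B s suc (λ k → ι (f (suc k) * k !)) ⟩
      ∑< B (λ k → ι (s C suc k) ⊗ G k) ∎

  cycle-index-sum : ∀ n → ∑∈ (partitions n) (λ μ → ι (permCount n μ) ⊗ xᵐ (length μ ∸ 1) ⊗ ι (sum (map f μ)))
                          ≈ ∑∈ (oneTo n) (λ k → ι (f k * (k ∸ 1) ! * (n C k)) ⊗ rising x (n ∸ k))
  cycle-index-sum n = begin
    ∑∈ (partitions n) g
      ≈⟨ ∑-partitions n g ⟩
    byFirstPart (suc n) n n g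
      ≈⟨ byFirstPart≈byMultiplicity n (suc n) n g (ℕ.n<1+n n) ⟩
    byMultiplicity n n g
      ≈⟨ byMultiplicity-cong n n (λ μ _ Σμ≡n → trans (*-assoc _ _ _)
           (*-cong (ι-cong (≡.cong (λ t → permCount t μ) (≡.sym Σμ≡n))) (marked≈ μ))) ⟩
    D n n
      ≈⟨ D-form n n ⟩
    ∑< n (λ k → ι (n C suc k) ⊗ (ι (f (suc k) * k !) ⊗ E n (n ∸ suc k)))
      ≈⟨ ∑<-cong n (λ k → trans (*-congˡ (*-congˡ (E-value n (n ∸ suc k) (ℕ.m∸n≤m n (suc k)))))
                                 (trans (sym (*-assoc _ _ _)) (*-congʳ (trans (*-comm _ _) (sym (ι-* (f (suc k) * k !) (n C suc k))))))) ⟩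
    ∑< n (λ k → ι (f (suc k) * k ! * (n C suc k)) ⊗ rising x (n ∸ suc k))
      ≈⟨ sym (∑∈-oneTo n (λ k → ι (f k * (k ∸ 1) ! * (n C k)) ⊗ rising x (n ∸ k))) ⟩
    ∑∈ (oneTo n) (λ k → ι (f k * (k ∸ 1) ! * (n C k)) ⊗ rising x (n ∸ k)) ∎
    where
    g : List ℕ → Carrier
    g μ = ι (permCount n μ) ⊗ xᵐ (length μ ∸ 1) ⊗ ι (sum (map f μ))

open import Data.Vec.Relation.Unary.All using (All)

mainTheorem7 : ∀ (m n : ℕ) → 1 ≤ m → 1 ≤ n → (rs : Vec ℕ m) → All (1 ≤_) rs →
    ∀ {c ℓ : Level} (R : CommutativeSemiring c ℓ) (x : CommutativeSemiring.Carrier R) →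
    CommutativeSemiring._≈_ R (Poly.lhs R n rs x) (Poly.mid R n rs x) ×
    CommutativeSemiring._≈_ R (Poly.mid R n rs x) (Poly.rhs R n rs x)
-- only 1 ≤ m is needed: it makes S_0 vanish
mainTheorem7 (suc m) n _ _ rs _ R x =
  CycleIndex.cycle-index-sum R (λ k → F k rs) x n ,
  RisingTransform.binomial-rising-transform R (λ k → F k rs) (λ k → S k rs) (λ k → Committees.F≡∑CS k rs) (Committees.S-zero rs) n x
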